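{- Let $M$ be an $s\times t$ matrix of rank $s$ with entries in $\mathbb{Z}$, all of absolute value at most $A$. Then there exists $\mathbf{b}\in\mathbb{Z}^t$ with $\|\mathbf{b}\|_1\le s^{s/2+1}A^{s-1}$ such that all $s$ coordinates of $M\mathbf{b}$ are strictly positive.
   Context: $\|\cdot\|_1$ denotes the $\ell_1$-norm. -}

module Defs where

open import Data.Nat as ℕ using (ℕ; zero; suc)
open import Data.Integer as ℤ using (ℤ; ∣_∣)
open import Data.Fin using (Fin; zero; suc)
open import Relation.Binary.PropositionalEquality using (_≡_)

Matrix : ℕ → ℕ → Set
Matrix s t = Fin s → Fin t → ℤ

Σℤ : (n : ℕ) → (Fin n → ℤ) → ℤ
Σℤ zero    f = ℤ.0ℤ
Σℤ (suc n) f = f zero ℤ.+ Σℤ n (λ i → f (suc i))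

Σℕ : (n : ℕ) → (Fin n → ℕ) → ℕ
Σℕ zero    f = 0
Σℕ (suc n) f = f zero ℕ.+ Σℕ n (λ i → f (suc i))

mulVec : {s t : ℕ} → Matrix s t → (Fin t → ℤ) → Fin s → ℤ
mulVec {s} {t} M b i = Σℤ t (λ j → M i j ℤ.* b j)

norm1 : {t : ℕ} → (Fin t → ℤ) → ℕ
norm1 {t} b = Σℕ t (λ j → ∣ b j ∣)

-- "M has rank s" for an s × t matrix: the s rows are linearly independent
-- (over ℤ, equivalently over ℚ by clearing denominators).
HasFullRowRank : {s t : ℕ} → Matrix s t → Set
HasFullRowRank {s} {t} M =
  (c : Fin s → ℤ) → ((j : Fin t) → Σℤ s (λ i → c i ℤ.* M i j) ≡ ℤ.0ℤ) → (i : Fin s) → c i ≡ ℤ.0ℤ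

-- Since M has full row rank, some s columns σ of M form a nonsingular matrix B: inductively
-- over the rows, if every extension of a nonsingular minor by one more column were singular,
-- the cofactors along that column would give a row dependency. By Cramer's rule the integer
-- vector x = adj(B)·𝟙 satisfies B x = det B · 𝟙, and each x_k is an s×s determinant with one
-- row of -1's and s - 1 rows that are columns of B, so Hadamard's inequality gives
-- x_k² ≤ s (s A²)^(s-1). Placing ±x on the columns σ gives b with M b = |det B| · 𝟙 > 0 and
-- ‖b‖₁² ≤ (s · max |x_k|)² ≤ s^(s+2) A^(2(s-1)).
--
-- With det given by Laplace expansion along the first column, invariance under transposition
-- and multiplicativity follow from the uniqueness of alternating multilinear forms; Hadamard's
-- inequality follows by induction from an integral Gram–Schmidt step on Gram determinants.

module Submission where

open import Defs

module FiniteSums where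

  open import Data.Nat using (ℕ; zero; suc)
  open import Data.Integer using (ℤ; 0ℤ; 1ℤ; _+_; _*_)
  open import Data.Integer.Properties
    using (+-*-semiring; +-identityʳ; *-zeroʳ; *-identityʳ)
  open import Data.Fin using (Fin; zero; suc; punchIn; punchOut)
  open import Data.Fin.Properties using (punchInᵢ≢i; punchIn-punchOut; punchIn-injective)
  open import Relation.Binary.PropositionalEquality
  open import Data.Empty using (⊥-elim)
  open import Function using (_∘_)

  open import Algebra.Properties.Semiring.Sum +-*-semiring public

  private
    variable
      n : ℕ

  Σℤ≡sum : ∀ n (f : Fin n → ℤ) → Σℤ n f ≡ sum f
  Σℤ≡sum zero    f = refl
  Σℤ≡sum (suc n) f = cong (f zero +_) (Σℤ≡sum n (λ i → f (suc i)))

  sum-zero : {f : Fin n → ℤ} → (∀ i → f i ≡ 0ℤ) → sum f ≡ 0ℤ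
  sum-zero {n} f≗0 = trans (sum-cong-≗ f≗0) (sum-replicate-zero n)

  sum-single : {f : Fin n → ℤ} (k : Fin n) → (∀ i → i ≢ k → f i ≡ 0ℤ) → sum f ≡ f k
  sum-single {suc n} {f} k f≗0 = begin
    sum f                                ≡⟨ sum-remove {i = k} f ⟩
    f k + sum (λ i → f (punchIn k i))    ≡⟨ cong (f k +_) (sum-zero (λ i → f≗0 _ (punchInᵢ≢i k i))) ⟩
    f k + 0ℤ                             ≡⟨ +-identityʳ (f k) ⟩
    f k                                  ∎
    where open ≡-Reasoning

  sum-pair : {f : Fin n → ℤ} (p q : Fin n) → p ≢ q →
             (∀ l → l ≢ p → l ≢ q → f l ≡ 0ℤ) → sum f ≡ f p + f q
  sum-pair {suc n} {f} p q p≢q f≗0 = begin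
    sum f                              ≡⟨ sum-remove {i = p} f ⟩
    f p + sum (λ i → f (punchIn p i))  ≡⟨ cong (f p +_) (sum-single q′ off-q′) ⟩
    f p + f (punchIn p q′)             ≡⟨ cong (λ l → f p + f l) (punchIn-punchOut p≢q) ⟩
    f p + f q                          ∎
    where
    open ≡-Reasoning
    q′ = punchOut p≢q
    off-q′ : ∀ i → i ≢ q′ → f (punchIn p i) ≡ 0ℤ
    off-q′ i i≢q′ = f≗0 _ (punchInᵢ≢i p i) λ eq →
      i≢q′ (punchIn-injective p i q′ (trans eq (sym (punchIn-punchOut p≢q))))

  δ : Fin n → Fin n → ℤ
  δ zero    zero    = 1ℤ
  δ zero    (suc j) = 0ℤ
  δ (suc i) zero    = 0ℤ
  δ (suc i) (suc j) = δ i j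

  δ-diag : (i : Fin n) → δ i i ≡ 1ℤ
  δ-diag zero    = refl
  δ-diag (suc i) = δ-diag i

  δ-off : (i j : Fin n) → i ≢ j → δ i j ≡ 0ℤ
  δ-off zero    zero    i≢j = ⊥-elim (i≢j refl)
  δ-off zero    (suc j) _   = refl
  δ-off (suc i) zero    _   = refl
  δ-off (suc i) (suc j) i≢j = δ-off i j (i≢j ∘ cong suc)

  δ-sym : (i j : Fin n) → δ i j ≡ δ j i
  δ-sym zero    zero    = refl
  δ-sym zero    (suc j) = refl
  δ-sym (suc i) zero    = refl
  δ-sym (suc i) (suc j) = δ-sym i j

  sum-δ : (g : Fin n → ℤ) (k : Fin n) → sum (λ l → g l * δ l k) ≡ g k
  sum-δ g k = trans (sum-single k (λ l l≢k → trans (cong (g l *_) (δ-off l k l≢k)) (*-zeroʳ (g l))))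
                    (trans (cong (g k *_) (δ-diag k)) (*-identityʳ (g k)))

module Determinant where

  open FiniteSums
  open import Data.Nat using (ℕ; zero; suc)
  open import Data.Integer using (ℤ; 0ℤ; 1ℤ; _+_; _*_; -_; _-_)
  open import Data.Integer.Properties using (+-inverseʳ; *-zeroʳ)
  open import Data.Integer.Tactic.RingSolver using (solve-∀)
  open import Data.Fin using (Fin; zero; suc; punchIn; punchOut; inject₁; _≟_)
  open import Data.Fin.Properties using (punchInᵢ≢i; punchIn-punchOut; punchIn-injective; suc-injective)
  open import Function using (_∘_)
  open import Relation.Binary.PropositionalEquality
  open import Relation.Nullary using (yes; no)

  private
    variable
      n : ℕ

  Mat : ℕ → Set
  Mat n = Matrix n n

  _ᵀ : Mat n → Mat n
  (A ᵀ) i j = A j i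

  I : Mat n
  I = δ

  sgn : Fin n → ℤ
  sgn zero    = 1ℤ
  sgn (suc i) = - sgn i

  minor : Fin (suc n) → Mat (suc n) → Mat n
  minor l A i j = A (punchIn l i) (suc j)

  det : Mat n → ℤ
  det {zero}  A = 1ℤ
  det {suc n} A = sum λ l → sgn l * (A l zero * det (minor l A))

  det-cong : {A B : Mat n} → (∀ i j → A i j ≡ B i j) → det A ≡ det B
  det-cong {zero}  A≗B = refl
  det-cong {suc n} A≗B = sum-cong-≗ λ l →
    cong₂ (λ x y → sgn l * (x * y)) (A≗B l zero) (det-cong (λ i j → A≗B (punchIn l i) (suc j)))

  det-linear-row : (r : Fin n) (A B C : Mat n) (c : ℤ) →
                   (∀ i j → i ≢ r → A i j ≡ B i j) → (∀ i j → i ≢ r → C i j ≡ B i j) →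
                   (∀ j → A r j ≡ c * B r j + C r j) → det A ≡ c * det B + det C
  det-linear-row {suc n} r A B C c A≈B C≈B Ar = begin
    det A                          ≡⟨ sum-cong-≗ term ⟩
    sum (λ l → c * T B l + T C l)  ≡⟨ ∑-distrib-+ (λ l → c * T B l) (T C) ⟩
    sum (λ l → c * T B l) + det C  ≡⟨ cong (_+ det C) (*-distribˡ-sum c (T B)) ⟨
    c * det B + det C              ∎
    where
    open ≡-Reasoning
    T : Mat (suc n) → Fin (suc n) → ℤ
    T X l = sgn l * (X l zero * det (minor l X))
    distrib-row : ∀ s c b k d → s * ((c * b + k) * d) ≡ c * (s * (b * d)) + s * (k * d)
    distrib-row = solve-∀
    distrib-minor : ∀ s x c y z → s * (x * (c * y + z)) ≡ c * (s * (x * y)) + s * (x * z)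
    distrib-minor = solve-∀
    term : ∀ l → T A l ≡ c * T B l + T C l
    term l with l ≟ r
    ... | yes refl = begin
      sgn l * (A l zero * det (minor l A))
        ≡⟨ cong₂ (λ x y → sgn l * (x * y)) (Ar zero) (det-cong λ i j → A≈B _ _ (punchInᵢ≢i l i)) ⟩
      sgn l * ((c * B l zero + C l zero) * det (minor l B))
        ≡⟨ distrib-row (sgn l) c (B l zero) (C l zero) (det (minor l B)) ⟩
      c * T B l + sgn l * (C l zero * det (minor l B))
        ≡⟨ cong (λ y → c * T B l + sgn l * (C l zero * y)) (det-cong λ i j → C≈B _ _ (punchInᵢ≢i l i)) ⟨
      c * T B l + T C l ∎
    ... | no l≢r = begin
      sgn l * (A l zero * det (minor l A))
        ≡⟨ cong₂ (λ x y → sgn l * (x * y)) (A≈B l zero l≢r) minor-linear ⟩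
      sgn l * (B l zero * (c * det (minor l B) + det (minor l C)))
        ≡⟨ distrib-minor (sgn l) (B l zero) c (det (minor l B)) (det (minor l C)) ⟩
      c * T B l + sgn l * (B l zero * det (minor l C))
        ≡⟨ cong (λ x → c * T B l + sgn l * (x * det (minor l C))) (C≈B l zero l≢r) ⟨
      c * T B l + T C l ∎
      where
      r′ = punchOut l≢r
      off-r′ : ∀ i → i ≢ r′ → punchIn l i ≢ r
      off-r′ i i≢r′ eq = i≢r′ (punchIn-injective l i r′ (trans eq (sym (punchIn-punchOut l≢r))))
      minor-linear : det (minor l A) ≡ c * det (minor l B) + det (minor l C)
      minor-linear = det-linear-row r′ (minor l A) (minor l B) (minor l C) c
        (λ i j → A≈B _ _ ∘ off-r′ i) (λ i j → C≈B _ _ ∘ off-r′ i)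
        (λ j → subst (λ x → A x (suc j) ≡ c * B x (suc j) + C x (suc j))
                     (sym (punchIn-punchOut l≢r)) (Ar (suc j)))

  data Adjacent : Fin n → Fin n → Set where
    zero-one : Adjacent {suc (suc n)} zero (suc zero)
    suc-suc  : {p q : Fin (suc n)} → Adjacent p q → Adjacent {suc (suc n)} (suc p) (suc q)

  inject₁-adjacent : (k : Fin n) → Adjacent (inject₁ k) (suc k)
  inject₁-adjacent zero    = zero-one
  inject₁-adjacent (suc k) = suc-suc (inject₁-adjacent k)

  adjacent⇒≢ : {p q : Fin n} → Adjacent p q → p ≢ q
  adjacent⇒≢ zero-one    ()
  adjacent⇒≢ (suc-suc a) eq = adjacent⇒≢ a (suc-injective eq)

  sgn-adjacent : {p q : Fin n} → Adjacent p q → sgn q ≡ - sgn p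
  sgn-adjacent zero-one    = refl
  sgn-adjacent (suc-suc a) = cong -_ (sgn-adjacent a)

  private
    punchIn≡zero : (l : Fin (suc (suc n))) (q : Fin (suc n)) → punchIn l q ≡ zero → q ≡ zero
    punchIn≡zero (suc l) zero _ = refl

  adjacent-punchIn : (l : Fin (suc n)) {p q : Fin n} →
                     Adjacent (punchIn l p) (punchIn l q) → Adjacent p q
  adjacent-punchIn zero (suc-suc a) = a
  adjacent-punchIn {suc (suc n)} (suc l) {zero} {suc q} a with punchIn l q in eq
  adjacent-punchIn {suc (suc n)} (suc l) {zero} {suc q} zero-one | zero
    with refl ← punchIn≡zero l q eq = zero-one
  adjacent-punchIn {suc (suc n)} (suc l) {suc p} {suc q} (suc-suc a) = suc-suc (adjacent-punchIn l a)

  removeAt-adjacent : {A : Set} (g : Fin (suc n) → A) {p q : Fin (suc n)} → Adjacent p q →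
                      g p ≡ g q → ∀ i → g (punchIn p i) ≡ g (punchIn q i)
  removeAt-adjacent g zero-one    gp≡gq zero    = sym gp≡gq
  removeAt-adjacent g zero-one    gp≡gq (suc i) = refl
  removeAt-adjacent g (suc-suc a) gp≡gq zero    = refl
  removeAt-adjacent g (suc-suc a) gp≡gq (suc i) = removeAt-adjacent (g ∘ suc) a gp≡gq i

  det-adjacent-rows : (A : Mat n) {p q : Fin n} → Adjacent p q → (∀ j → A p j ≡ A q j) → det A ≡ 0ℤ
  det-adjacent-rows {suc n} A {p} {q} adj Ap≡Aq = begin
    det A      ≡⟨ sum-pair p q (adjacent⇒≢ adj) other-terms ⟩
    T p + T q  ≡⟨ cong (T p +_) Tq≡-Tp ⟩
    T p - T p  ≡⟨ +-inverseʳ (T p) ⟩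
    0ℤ         ∎
    where
    open ≡-Reasoning
    T : Fin (suc n) → ℤ
    T l = sgn l * (A l zero * det (minor l A))
    Tq≡-Tp : T q ≡ - T p
    Tq≡-Tp = begin
      sgn q * (A q zero * det (minor q A))
        ≡⟨ cong₂ (λ x y → x * (y * det (minor q A))) (sgn-adjacent adj) (sym (Ap≡Aq zero)) ⟩
      - sgn p * (A p zero * det (minor q A))
        ≡⟨ cong (λ y → - sgn p * (A p zero * y))
                (det-cong λ i j → sym (removeAt-adjacent (λ x → A x (suc j)) adj (Ap≡Aq (suc j)) i)) ⟩
      - sgn p * (A p zero * det (minor p A))
        ≡⟨ neg-first (sgn p) (A p zero * det (minor p A)) ⟩
      - T p ∎
      where
      neg-first : ∀ x y → - x * y ≡ - (x * y)
      neg-first = solve-∀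
    other-terms : ∀ l → l ≢ p → l ≢ q → T l ≡ 0ℤ
    other-terms l l≢p l≢q = begin
      sgn l * (A l zero * det (minor l A)) ≡⟨ cong (λ y → sgn l * (A l zero * y)) minor-vanishes ⟩
      sgn l * (A l zero * 0ℤ)               ≡⟨ cong (sgn l *_) (*-zeroʳ (A l zero)) ⟩
      sgn l * 0ℤ                            ≡⟨ *-zeroʳ (sgn l) ⟩
      0ℤ                                    ∎
      where
      p-in = punchIn-punchOut l≢p
      q-in = punchIn-punchOut l≢q
      minor-vanishes : det (minor l A) ≡ 0ℤ
      minor-vanishes = det-adjacent-rows (minor l A)
        (adjacent-punchIn l (subst₂ Adjacent (sym p-in) (sym q-in) adj))
        (λ j → trans (cong (λ x → A x (suc j)) p-in) (trans (Ap≡Aq (suc j)) (cong (λ x → A x (suc j)) (sym q-in))))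

module AlternatingForms where

  open FiniteSums
  open Determinant
  open import Data.Nat as ℕ using (ℕ; zero; suc)
  import Data.Nat.Properties as ℕ
  open import Data.Integer using (ℤ; 0ℤ; 1ℤ; _+_; _*_; -_; _-_)
  open import Data.Integer.Properties
    using (+-identityˡ; +-identityʳ; *-identityˡ; *-zeroʳ; +-inverseˡ; neg-involutive; neg-distribˡ-*)
  open import Data.Integer.Tactic.RingSolver using (solve-∀)
  open import Data.Fin using (Fin; zero; suc; toℕ; fromℕ<; inject₁; punchIn; punchOut; _≟_; _<_)
  open import Data.Fin.Properties
    using (toℕ-inject₁; toℕ-injective; toℕ<n; toℕ-fromℕ<; <-cmp; <⇒≢;
           suc-injective; punchIn-punchOut; punchIn-injective; punchInᵢ≢i)
  open import Data.Fin.Induction using (<-weakInduction)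
  open import Data.Vec.Functional using (updateAt; insertAt)
  open import Data.Vec.Functional.Properties
    using (updateAt-updates; updateAt-minimal; insertAt-lookup; insertAt-punchIn)
  open import Function using (_∘_)
  open import Relation.Binary.PropositionalEquality
  open import Relation.Binary.Definitions using (tri<; tri≈; tri>)
  open import Relation.Nullary using (¬_; yes; no)
  open import Data.Empty using (⊥-elim)

  private
    variable
      n : ℕ

  setCol : Mat n → Fin n → (Fin n → ℤ) → Mat n
  setCol A k v i = updateAt (A i) k (λ _ → v i)

  setCol-hit : (A : Mat n) (k : Fin n) (v : Fin n → ℤ) (i : Fin n) → setCol A k v i k ≡ v i
  setCol-hit A k v i = updateAt-updates k (A i)

  setCol-miss : (A : Mat n) {k j : Fin n} (v : Fin n → ℤ) (i : Fin n) → j ≢ k → setCol A k v i j ≡ A i j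
  setCol-miss A {k} {j} v i = updateAt-minimal j k (A i)

  setCol₂-≗ : {p q : Fin n} (A X : Mat n) (u v : Fin n → ℤ) → p ≢ q →
              (∀ i → X i p ≡ u i) → (∀ i → X i q ≡ v i) → (∀ i j → j ≢ p → j ≢ q → X i j ≡ A i j) →
              ∀ i j → setCol (setCol A p u) q v i j ≡ X i j
  setCol₂-≗ {p = p} {q} A X u v p≢q Xp Xq X-elsewhere i j with j ≟ q | j ≟ p
  ... | yes refl | _        = trans (setCol-hit (setCol A p u) q v i) (sym (Xq i))
  ... | no j≢q   | yes refl = trans (setCol-miss (setCol A p u) v i j≢q) (trans (setCol-hit A p u i) (sym (Xp i)))
  ... | no j≢q   | no j≢p   = trans (setCol-miss (setCol A p u) v i j≢q)
                                    (trans (setCol-miss A u i j≢p) (sym (X-elsewhere i j j≢p j≢q)))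

  swapCols : Fin n → Fin n → Mat n → Mat n
  swapCols p q A = setCol (setCol A p (λ i → A i q)) q (λ i → A i p)

  Cong : (Mat n → ℤ) → Set
  Cong f = ∀ {A B} → (∀ i j → A i j ≡ B i j) → f A ≡ f B

  Linear : (Mat n → ℤ) → Set
  Linear {n} f = ∀ (k : Fin n) (A B C : Mat n) (c : ℤ) →
                 (∀ i j → j ≢ k → A i j ≡ B i j) → (∀ i j → j ≢ k → C i j ≡ B i j) →
                 (∀ i → A i k ≡ c * B i k + C i k) → f A ≡ c * f B + f C

  Alternating : (Mat n → ℤ) → Set
  Alternating {n} f = ∀ (A : Mat n) (p q : Fin n) → p ≢ q → (∀ i → A i p ≡ A i q) → f A ≡ 0ℤ

  record AlternatingMultilinear (f : Mat n → ℤ) : Set where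
    field
      cong-≗      : Cong f
      linear      : Linear f
      alternating : Alternating f

  biadditive-alternating⇒antisymmetric :
    {V : Set} (_⊕_ : V → V → V) (φ : V → V → ℤ) →
    (∀ u v w → φ (u ⊕ v) w ≡ φ u w + φ v w) → (∀ u v w → φ u (v ⊕ w) ≡ φ u v + φ u w) →
    (∀ u → φ u u ≡ 0ℤ) → ∀ u v → φ v u ≡ - φ u v
  biadditive-alternating⇒antisymmetric _⊕_ φ addˡ addʳ alt u v = begin
    φ v u                                ≡⟨ cancel (φ u v) (φ v u) ⟩
    - φ u v + (0ℤ + φ u v + (φ v u + 0ℤ)) ≡⟨ cong (λ x → - φ u v + x) expand-diagonal ⟨
    - φ u v + 0ℤ                         ≡⟨ +-identityʳ (- φ u v) ⟩
    - φ u v                              ∎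
    where
    open ≡-Reasoning
    cancel : ∀ x y → y ≡ - x + (0ℤ + x + (y + 0ℤ))
    cancel = solve-∀
    expand-diagonal : 0ℤ ≡ 0ℤ + φ u v + (φ v u + 0ℤ)
    expand-diagonal = begin
      0ℤ                                ≡⟨ alt (u ⊕ v) ⟨
      φ (u ⊕ v) (u ⊕ v)                 ≡⟨ addˡ u v (u ⊕ v) ⟩
      φ u (u ⊕ v) + φ v (u ⊕ v)         ≡⟨ cong₂ _+_ (addʳ u u v) (addʳ v u v) ⟩
      φ u u + φ u v + (φ v u + φ v v)   ≡⟨ cong₂ (λ x y → x + φ u v + (φ v u + y)) (alt u) (alt v) ⟩
      0ℤ + φ u v + (φ v u + 0ℤ)         ∎

  module _ {f : Mat n → ℤ} (f-linear : Linear f) where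

    linear-zero-column : (A : Mat n) (k : Fin n) → (∀ i → A i k ≡ 0ℤ) → f A ≡ 0ℤ
    linear-zero-column A k Ak≡0 = begin
      f A                       ≡⟨ x≡-x+[1*x+x] (f A) ⟩
      - f A + (1ℤ * f A + f A)  ≡⟨ cong (- f A +_) doubled ⟨
      - f A + f A               ≡⟨ +-inverseˡ (f A) ⟩
      0ℤ                        ∎
      where
      open ≡-Reasoning
      x≡-x+[1*x+x] : ∀ x → x ≡ - x + (1ℤ * x + x)
      x≡-x+[1*x+x] = solve-∀
      doubled : f A ≡ 1ℤ * f A + f A
      doubled = f-linear k A A A 1ℤ (λ _ _ _ → refl) (λ _ _ _ → refl)
        (λ i → trans (Ak≡0 i) (sym (cong₂ (λ x y → 1ℤ * x + y) (Ak≡0 i) (Ak≡0 i))))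

    column-additive : (X : Mat n) (k : Fin n) (u v : Fin n → ℤ) →
                      f (setCol X k (λ i → u i + v i)) ≡ f (setCol X k u) + f (setCol X k v)
    column-additive X k u v = trans
      (f-linear k (setCol X k u+v) (setCol X k u) (setCol X k v) 1ℤ
        (λ i j j≢k → trans (setCol-miss X u+v i j≢k) (sym (setCol-miss X u i j≢k)))
        (λ i j j≢k → trans (setCol-miss X v i j≢k) (sym (setCol-miss X u i j≢k)))
        (λ i → trans (setCol-hit X k u+v i)
                     (sym (trans (cong₂ (λ x y → 1ℤ * x + y) (setCol-hit X k u i) (setCol-hit X k v i))
                                 (cong (_+ v i) (*-identityˡ (u i)))))))
      (cong (_+ f (setCol X k v)) (*-identityˡ (f (setCol X k u))))
      where
      u+v : Fin n → ℤ
      u+v i = u i + v i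

    linear-sum : ∀ {m} (A : Mat n) (k : Fin n) (g : Fin m → ℤ) (h : Fin m → Fin n → ℤ) →
                 f (setCol A k (λ i → sum (λ l → g l * h l i))) ≡ sum (λ l → g l * f (setCol A k (h l)))
    linear-sum {zero}  A k g h = linear-zero-column _ k (setCol-hit A k _)
    linear-sum {suc m} A k g h = trans
      (f-linear k (setCol A k total) (setCol A k (h zero)) (setCol A k rest) (g zero)
        (λ i j j≢k → trans (setCol-miss A total i j≢k) (sym (setCol-miss A (h zero) i j≢k)))
        (λ i j j≢k → trans (setCol-miss A rest i j≢k) (sym (setCol-miss A (h zero) i j≢k)))
        (λ i → trans (setCol-hit A k total i)
                     (sym (cong₂ (λ x y → g zero * x + y) (setCol-hit A k (h zero) i) (setCol-hit A k rest i)))))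
      (cong (g zero * f (setCol A k (h zero)) +_) (linear-sum A k (g ∘ suc) (h ∘ suc)))
      where
      total rest : Fin n → ℤ
      total i = sum (λ l → g l * h l i)
      rest i = sum (λ l → g (suc l) * h (suc l) i)

    add-column-multiple : Alternating f → {p q : Fin n} → p ≢ q → (Z W : Mat n) (c : ℤ) →
                          (∀ i j → j ≢ q → Z i j ≡ W i j) → (∀ i → Z i q ≡ c * W i p + W i q) → f Z ≡ f W
    add-column-multiple f-alt {p} {q} p≢q Z W c Z≈W Zq = begin
      f Z            ≡⟨ f-linear q Z D W c Z≈D (λ i j j≢q → sym (setCol-miss W Wp i j≢q)) Zq≡cDq+Wq ⟩
      c * f D + f W  ≡⟨ cong (λ x → c * x + f W) (f-alt D p q p≢q Dp≡Dq) ⟩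
      c * 0ℤ + f W   ≡⟨ cong (_+ f W) (*-zeroʳ c) ⟩
      0ℤ + f W       ≡⟨ +-identityˡ (f W) ⟩
      f W            ∎
      where
      open ≡-Reasoning
      Wp : Fin n → ℤ
      Wp i = W i p
      D : Mat n
      D = setCol W q Wp
      Z≈D : ∀ i j → j ≢ q → Z i j ≡ D i j
      Z≈D i j j≢q = trans (Z≈W i j j≢q) (sym (setCol-miss W Wp i j≢q))
      Zq≡cDq+Wq : ∀ i → Z i q ≡ c * D i q + W i q
      Zq≡cDq+Wq i = trans (Zq i) (cong (λ x → c * x + W i q) (sym (setCol-hit W q Wp i)))
      Dp≡Dq : ∀ i → D i p ≡ D i q
      Dp≡Dq i = trans (setCol-miss W Wp i p≢q) (sym (setCol-hit W q Wp i))

    swap-columns : Cong f → {p q : Fin n} → p ≢ q → (∀ X → (∀ i → X i p ≡ X i q) → f X ≡ 0ℤ) →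
                   ∀ A → f (swapCols p q A) ≡ - f A
    swap-columns f-cong {p} {q} p≢q alt-pq A = begin
      φ Aq Ap    ≡⟨ biadditive-alternating⇒antisymmetric _⊕_ φ addˡ addʳ alt Ap Aq ⟩
      - φ Ap Aq  ≡⟨ cong -_ (f-cong (setCol₂-≗ A A Ap Aq p≢q (λ _ → refl) (λ _ → refl) (λ _ _ _ _ → refl))) ⟩
      - f A      ∎
      where
      open ≡-Reasoning
      Ap Aq : Fin n → ℤ
      Ap i = A i p
      Aq i = A i q
      _⊕_ : (Fin n → ℤ) → (Fin n → ℤ) → Fin n → ℤ
      (u ⊕ v) i = u i + v i
      φ : (Fin n → ℤ) → (Fin n → ℤ) → ℤ
      φ u v = f (setCol (setCol A p u) q v)
      commute : ∀ u v → ∀ i j → setCol (setCol A p u) q v i j ≡ setCol (setCol A q v) p u i j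
      commute u v = setCol₂-≗ A (setCol (setCol A q v) p u) u v p≢q
        (setCol-hit (setCol A q v) p u)
        (λ i → trans (setCol-miss (setCol A q v) u i (p≢q ∘ sym)) (setCol-hit A q v i))
        (λ i j j≢p j≢q → trans (setCol-miss (setCol A q v) u i j≢p) (setCol-miss A v i j≢q))
      addʳ : ∀ u v w → φ u (v ⊕ w) ≡ φ u v + φ u w
      addʳ u = column-additive (setCol A p u) q
      addˡ : ∀ u v w → φ (u ⊕ v) w ≡ φ u w + φ v w
      addˡ u v w = trans (f-cong (commute (u ⊕ v) w))
        (trans (column-additive (setCol A q w) p u v)
               (sym (cong₂ _+_ (f-cong (commute u w)) (f-cong (commute v w)))))
      alt : ∀ u → φ u u ≡ 0ℤ
      alt u = alt-pq _ λ i →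
        trans (setCol-miss (setCol A p u) u i p≢q) (trans (setCol-hit A p u i) (sym (setCol-hit (setCol A p u) q u i)))

  module _ {f : Mat (suc n) → ℤ} (f-cong : Cong f) (f-linear : Linear f)
           (adj-alt : ∀ A {p q} → Adjacent p q → (∀ i → A i p ≡ A i q) → f A ≡ 0ℤ) where

    private
      P : Fin (suc n) → Set
      P q = ∀ {p} A → p < q → (∀ i → A i p ≡ A i q) → f A ≡ 0ℤ

      P-suc : ∀ j → P (inject₁ j) → P (suc j)
      P-suc j ih {p} A p<1+j Ap≡A1+j with toℕ p ℕ.≟ toℕ j
      ... | yes p≡j = adj-alt A (subst (λ x → Adjacent x (suc j)) (sym p≡inject₁j) (inject₁-adjacent j)) Ap≡A1+j
        where
        p≡inject₁j : p ≡ inject₁ j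
        p≡inject₁j = toℕ-injective (trans p≡j (sym (toℕ-inject₁ j)))
      ... | no p≢j = begin
        f A          ≡⟨ neg-involutive (f A) ⟨
        - - f A      ≡⟨ cong -_ (swap-columns f-linear f-cong (adjacent⇒≢ adj) (λ X → adj-alt X adj) A) ⟨
        - f A′       ≡⟨ cong -_ (ih A′ p<inject₁j A′p≡A′j) ⟩
        - 0ℤ         ≡⟨⟩
        0ℤ           ∎
        where
        open ≡-Reasoning
        adj = inject₁-adjacent j
        A′ = swapCols (inject₁ j) (suc j) A
        p<inject₁j : p < inject₁ j
        p<inject₁j = subst (toℕ p ℕ.<_) (sym (toℕ-inject₁ j)) (ℕ.≤∧≢⇒< (ℕ.s≤s⁻¹ p<1+j) p≢j)
        A′p≡A′j : ∀ i → A′ i p ≡ A′ i (inject₁ j)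
        A′p≡A′j i = begin
          A′ i p                   ≡⟨ setCol-miss B Aj i (<⇒≢ p<1+j) ⟩
          B i p                    ≡⟨ setCol-miss A A1+j i (<⇒≢ p<inject₁j) ⟩
          A i p                    ≡⟨ Ap≡A1+j i ⟩
          A i (suc j)              ≡⟨ setCol-hit A (inject₁ j) A1+j i ⟨
          B i (inject₁ j)          ≡⟨ setCol-miss B Aj i (adjacent⇒≢ adj) ⟨
          A′ i (inject₁ j)         ∎
          where
          Aj A1+j : Fin (suc n) → ℤ
          Aj i = A i (inject₁ j)
          A1+j i = A i (suc j)
          B = setCol A (inject₁ j) A1+j

    equal-columns-vanish : ∀ q {p} A → p < q → (∀ i → A i p ≡ A i q) → f A ≡ 0ℤ
    equal-columns-vanish = <-weakInduction P (λ _ ()) P-suc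

  alternating-from-adjacent : {f : Mat n → ℤ} → Cong f → Linear f →
    (∀ A {p q} → Adjacent p q → (∀ i → A i p ≡ A i q) → f A ≡ 0ℤ) → Alternating f
  alternating-from-adjacent {suc n} f-cong f-linear adj-alt A p q p≢q Ap≡Aq with <-cmp p q
  ... | tri< p<q _ _ = equal-columns-vanish f-cong f-linear adj-alt q A p<q Ap≡Aq
  ... | tri≈ _ p≡q _ = ⊥-elim (p≢q p≡q)
  ... | tri> _ _ q<p = equal-columns-vanish f-cong f-linear adj-alt p A q<p (sym ∘ Ap≡Aq)

  hybrid : ℕ → Mat n → Mat n → Mat n
  hybrid k X Y i j with toℕ j ℕ.<? k
  ... | yes _ = Y i j
  ... | no  _ = X i j

  hybrid-< : (k : ℕ) (X Y : Mat n) (i j : Fin n) → toℕ j ℕ.< k → hybrid k X Y i j ≡ Y i j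
  hybrid-< k X Y i j j<k with toℕ j ℕ.<? k
  ... | yes _   = refl
  ... | no  j≮k = ⊥-elim (j≮k j<k)

  hybrid-≥ : (k : ℕ) (X Y : Mat n) (i j : Fin n) → ¬ toℕ j ℕ.< k → hybrid k X Y i j ≡ X i j
  hybrid-≥ k X Y i j j≮k with toℕ j ℕ.<? k
  ... | yes j<k = ⊥-elim (j≮k j<k)
  ... | no  _   = refl

  hybrid-step : (X Y : Mat n) (q i j : Fin n) → j ≢ q →
                hybrid (suc (toℕ q)) X Y i j ≡ hybrid (toℕ q) X Y i j
  hybrid-step X Y q i j j≢q with ℕ.<-cmp (toℕ j) (toℕ q)
  ... | tri< j<q _ _ = trans (hybrid-< _ X Y i j (ℕ.m<n⇒m<1+n j<q)) (sym (hybrid-< _ X Y i j j<q))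
  ... | tri≈ _ j≡q _ = ⊥-elim (j≢q (toℕ-injective j≡q))
  ... | tri> _ _ q<j = trans (hybrid-≥ _ X Y i j (ℕ.≤⇒≯ q<j)) (sym (hybrid-≥ _ X Y i j (ℕ.<⇒≯ q<j)))

  hybrid-chain : {f : Mat n → ℤ} → Cong f → (X Y : Mat n) →
                 (∀ q → f (hybrid (suc (toℕ q)) X Y) ≡ f (hybrid (toℕ q) X Y)) → f Y ≡ f X
  hybrid-chain {n} {f} f-cong X Y step = trans
    (f-cong λ i j → sym (hybrid-< n X Y i j (toℕ<n j)))
    (from-start n ℕ.≤-refl)
    where
    from-start : ∀ k → k ℕ.≤ n → f (hybrid k X Y) ≡ f X
    from-start zero    _   = f-cong λ i j → hybrid-≥ 0 X Y i j λ ()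
    from-start (suc k) k<n = trans
      (subst (λ m → f (hybrid (suc m) X Y) ≡ f (hybrid m X Y)) (toℕ-fromℕ< k<n) (step (fromℕ< k<n)))
      (from-start k (ℕ.<⇒≤ k<n))

  pointwise-by-punchIn : {A : Set} (l : Fin (suc n)) {F G : Fin (suc n) → A} → F l ≡ G l →
                         (∀ i → F (punchIn l i) ≡ G (punchIn l i)) → ∀ i → F i ≡ G i
  pointwise-by-punchIn l {F} {G} Fl≡Gl F≈G i with l ≟ i
  ... | yes refl = Fl≡Gl
  ... | no  l≢i  = subst (λ x → F x ≡ G x) (punchIn-punchOut l≢i) (F≈G (punchOut l≢i))

  insertAt-unique : {A : Set} (xs : Fin n → A) (l : Fin (suc n)) (v : A) (F : Fin (suc n) → A) →
                    v ≡ F l → (∀ i → xs i ≡ F (punchIn l i)) → ∀ i → insertAt xs l v i ≡ F i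
  insertAt-unique xs l v F v≡Fl xs≈F = pointwise-by-punchIn l
    (trans (insertAt-lookup xs l v) v≡Fl)
    (λ i → trans (insertAt-punchIn xs l v i) (xs≈F i))

  insertAt-cong : {A : Set} {xs ys : Fin n → A} (l : Fin (suc n)) (v : A) →
                  (∀ i → xs i ≡ ys i) → ∀ i → insertAt xs l v i ≡ insertAt ys l v i
  insertAt-cong {ys = ys} l v xs≗ys = insertAt-unique _ l v (insertAt ys l v)
    (sym (insertAt-lookup ys l v)) (λ i → trans (xs≗ys i) (sym (insertAt-punchIn ys l v i)))

  δ-punchIn : (l : Fin (suc n)) (a b : Fin n) → δ (punchIn l a) (punchIn l b) ≡ δ a b
  δ-punchIn l a b with a ≟ b
  ... | yes refl = trans (δ-diag (punchIn l a)) (sym (δ-diag a))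
  ... | no  a≢b  = trans (δ-off _ _ (a≢b ∘ punchIn-injective l a b)) (sym (δ-off a b a≢b))

  embed : Fin (suc n) → Mat n → Mat (suc n)
  embed l C i zero    = δ i l
  embed l C i (suc j) = insertAt (λ i′ → C i′ j) l 0ℤ i

  module _ {f : Mat (suc n) → ℤ} (f-am : AlternatingMultilinear f) where

    open AlternatingMultilinear f-am

    embed-alternatingMultilinear : (l : Fin (suc n)) → AlternatingMultilinear (f ∘ embed l)
    embed-alternatingMultilinear l = record
      { cong-≗      = λ C≗D → cong-≗ (embed-cong C≗D)
      ; linear      = embed-linear
      ; alternating = λ C p q p≢q Cp≡Cq →
          alternating (embed l C) (suc p) (suc q) (p≢q ∘ suc-injective) (insertAt-cong l 0ℤ Cp≡Cq)
      }
      where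
      embed-cong : {C D : Mat n} → (∀ i j → C i j ≡ D i j) → ∀ i j → embed l C i j ≡ embed l D i j
      embed-cong C≗D i zero    = refl
      embed-cong C≗D i (suc j) = insertAt-cong l 0ℤ (λ i′ → C≗D i′ j) i
      embed-linear : Linear (f ∘ embed l)
      embed-linear k C₁ C₂ C₃ c C₁≈C₂ C₃≈C₂ C₁k = linear (suc k) (embed l C₁) (embed l C₂) (embed l C₃) c
        (λ { i zero _ → refl ; i (suc j) j≢k → insertAt-cong l 0ℤ (λ i′ → C₁≈C₂ i′ j (j≢k ∘ cong suc)) i })
        (λ { i zero _ → refl ; i (suc j) j≢k → insertAt-cong l 0ℤ (λ i′ → C₃≈C₂ i′ j (j≢k ∘ cong suc)) i })
        (insertAt-unique _ l 0ℤ (λ i → c * embed l C₂ i (suc k) + embed l C₃ i (suc k))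
          (sym (trans (cong₂ (λ x y → c * x + y) (insertAt-lookup _ l 0ℤ) (insertAt-lookup _ l 0ℤ))
                      (trans (+-identityʳ (c * 0ℤ)) (*-zeroʳ c))))
          (λ i′ → trans (C₁k i′)
                        (sym (cong₂ (λ x y → c * x + y) (insertAt-punchIn _ l 0ℤ i′) (insertAt-punchIn _ l 0ℤ i′)))))

    clear-row : (A : Mat (suc n)) (l : Fin (suc n)) → f (setCol A zero (λ i → δ i l)) ≡ f (embed l (minor l A))
    clear-row A l = sym (hybrid-chain cong-≗ X Y replace-column)
      where
      eₗ : Fin (suc n) → ℤ
      eₗ i = δ i l
      X Y : Mat (suc n)
      X = setCol A zero eₗ
      Y = embed l (minor l A)
      Y≡-Alq*δ+X : ∀ j i → Y i (suc j) ≡ - A l (suc j) * δ i l + X i (suc j)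
      Y≡-Alq*δ+X j i = trans
        (insertAt-unique _ l 0ℤ (λ i → - A l (suc j) * δ i l + A i (suc j))
          (sym (trans (cong (λ x → - A l (suc j) * x + A l (suc j)) (δ-diag l)) (-a*1+a≡0 (A l (suc j)))))
          (λ i′ → sym (trans (cong (λ x → - A l (suc j) * x + A (punchIn l i′) (suc j)) (δ-off _ _ (punchInᵢ≢i l i′)))
                             (trans (cong (_+ A (punchIn l i′) (suc j)) (*-zeroʳ (- A l (suc j))))
                                    (+-identityˡ (A (punchIn l i′) (suc j))))))
          i)
        (cong (- A l (suc j) * δ i l +_) (sym (setCol-miss A {zero} {suc j} eₗ i λ ())))
        where
        -a*1+a≡0 : ∀ a → - a * 1ℤ + a ≡ 0ℤ
        -a*1+a≡0 = solve-∀
      replace-column : ∀ q → f (hybrid (suc (toℕ q)) X Y) ≡ f (hybrid (toℕ q) X Y)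
      replace-column zero    = cong-≗ λ where
        i zero    → trans (hybrid-< 1 X Y i zero ℕ.z<s) (sym (trans (hybrid-≥ 0 X Y i zero λ ()) (setCol-hit A zero eₗ i)))
        i (suc j) → hybrid-step X Y zero i (suc j) λ ()
      replace-column (suc j) = add-column-multiple linear alternating {zero} {suc j} (λ ()) Z W (- A l (suc j))
        (hybrid-step X Y (suc j))
        (λ i → begin
          Z i (suc j)                                ≡⟨ hybrid-< _ X Y i (suc j) ℕ.≤-refl ⟩
          Y i (suc j)                                ≡⟨ Y≡-Alq*δ+X j i ⟩
          - A l (suc j) * δ i l + X i (suc j)        ≡⟨ cong₂ (λ x y → - A l (suc j) * x + y) (W0 i)
                                                             (hybrid-≥ _ X Y i (suc j) (ℕ.<-irrefl refl)) ⟨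
          - A l (suc j) * W i zero + W i (suc j)     ∎)
        where
        open ≡-Reasoning
        Z W : Mat (suc n)
        Z = hybrid (suc (toℕ (suc j))) X Y
        W = hybrid (toℕ (suc j)) X Y
        W0 : ∀ i → W i zero ≡ δ i l
        W0 i = hybrid-< (toℕ (suc j)) X Y i zero ℕ.z<s

  punchIn-inject₁-self : (l : Fin n) → punchIn (inject₁ l) l ≡ suc l
  punchIn-inject₁-self zero    = refl
  punchIn-inject₁-self (suc l) = cong suc (punchIn-inject₁-self l)

  punchIn-suc-self : (l : Fin n) → punchIn (suc l) l ≡ inject₁ l
  punchIn-suc-self zero    = refl
  punchIn-suc-self (suc l) = cong suc (punchIn-suc-self l)

  punchIn-suc≡punchIn-inject₁ : (l j : Fin n) → j ≢ l → punchIn (suc l) j ≡ punchIn (inject₁ l) j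
  punchIn-suc≡punchIn-inject₁ zero    zero    j≢l = ⊥-elim (j≢l refl)
  punchIn-suc≡punchIn-inject₁ zero    (suc j) _   = refl
  punchIn-suc≡punchIn-inject₁ (suc l) zero    _   = refl
  punchIn-suc≡punchIn-inject₁ (suc l) (suc j) j≢l = cong suc (punchIn-suc≡punchIn-inject₁ l j (j≢l ∘ cong suc))

  sgn-inject₁ : (l : Fin n) → sgn (inject₁ l) ≡ sgn l
  sgn-inject₁ zero    = refl
  sgn-inject₁ (suc l) = cong -_ (sgn-inject₁ l)

  cycleMatrix : Fin (suc n) → Mat (suc n)
  cycleMatrix l i zero    = δ i l
  cycleMatrix l i (suc j) = δ i (punchIn l j)

  embed-I : (l : Fin (suc n)) → ∀ i j → embed l I i j ≡ cycleMatrix l i j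
  embed-I l i zero    = refl
  embed-I l i (suc j) = insertAt-unique _ l 0ℤ (λ i → δ i (punchIn l j))
    (sym (δ-off l _ (punchInᵢ≢i l j ∘ sym))) (λ i′ → sym (δ-punchIn l i′ j)) i

  module _ {f : Mat (suc n) → ℤ} (f-am : AlternatingMultilinear f) where

    open AlternatingMultilinear f-am

    cycleMatrix-sign : (l : Fin (suc n)) → f (cycleMatrix l) ≡ sgn l * f I
    cycleMatrix-sign = <-weakInduction (λ l → f (cycleMatrix l) ≡ sgn l * f I) base step
      where
      base : f (cycleMatrix zero) ≡ 1ℤ * f I
      base = trans (cong-≗ λ { i zero → refl ; i (suc j) → refl }) (sym (*-identityˡ (f I)))
      step : ∀ l → f (cycleMatrix (inject₁ l)) ≡ sgn (inject₁ l) * f I →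
             f (cycleMatrix (suc l)) ≡ sgn (suc l) * f I
      step l ih = begin
        f (cycleMatrix (suc l))
          ≡⟨ cong-≗ swapped ⟨
        f (swapCols zero (suc l) (cycleMatrix (inject₁ l)))
          ≡⟨ swap-columns linear cong-≗ (λ ()) (λ X → alternating X zero (suc l) (λ ())) _ ⟩
        - f (cycleMatrix (inject₁ l))
          ≡⟨ cong -_ (trans ih (cong (_* f I) (sgn-inject₁ l))) ⟩
        - (sgn l * f I)
          ≡⟨ neg-distribˡ-* (sgn l) (f I) ⟩
        - sgn l * f I ∎
        where
        open ≡-Reasoning
        swapped : ∀ i j → swapCols zero (suc l) (cycleMatrix (inject₁ l)) i j ≡ cycleMatrix (suc l) i j
        swapped = setCol₂-≗ (cycleMatrix (inject₁ l)) (cycleMatrix (suc l)) _ _ (λ ())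
          (λ i → cong (δ i) (sym (punchIn-inject₁-self l)))
          (λ i → cong (δ i) (punchIn-suc-self l))
          λ { i zero j≢0 _ → ⊥-elim (j≢0 refl)
            ; i (suc j) _ j≢l → cong (δ i) (punchIn-suc≡punchIn-inject₁ l j (j≢l ∘ cong suc)) }

  -- Expand the first column of A in the standard basis. Once the first column is e_l, adding
  -- multiples of it clears row l, leaving embed l (minor l A); f ∘ embed l is again alternating
  -- multilinear, so induction applies, and cycleMatrix-sign evaluates it at I.
  det-unique : {f : Mat n → ℤ} → AlternatingMultilinear f → ∀ A → f A ≡ det A * f I
  det-unique {zero} f-am A = trans (cong-≗ λ ()) (sym (*-identityˡ _))
    where open AlternatingMultilinear f-am
  det-unique {suc n} {f} f-am A = begin
    f A
      ≡⟨ cong-≗ first-column-expanded ⟩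
    f (setCol A zero expanded)
      ≡⟨ linear-sum linear A zero (λ l → A l zero) (λ l i → δ i l) ⟩
    sum (λ l → A l zero * f (setCol A zero (λ i → δ i l)))
      ≡⟨ sum-cong-≗ (λ l → cong (A l zero *_) (unit-first-column l)) ⟩
    sum (λ l → A l zero * (det (minor l A) * (sgn l * f I)))
      ≡⟨ sum-cong-≗ (λ l → reorder (A l zero) (det (minor l A)) (sgn l) (f I)) ⟩
    sum (λ l → sgn l * (A l zero * det (minor l A)) * f I)
      ≡⟨ *-distribʳ-sum (f I) (λ l → sgn l * (A l zero * det (minor l A))) ⟨
    det A * f I ∎
    where
    open ≡-Reasoning
    open AlternatingMultilinear f-am
    reorder : ∀ a d s x → a * (d * (s * x)) ≡ s * (a * d) * x
    reorder = solve-∀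
    expanded : Fin (suc n) → ℤ
    expanded i = sum λ l → A l zero * δ i l
    first-column-expanded : ∀ i j → A i j ≡ setCol A zero expanded i j
    first-column-expanded i zero    = sym (trans (setCol-hit A zero expanded i)
      (trans (sum-cong-≗ λ l → cong (A l zero *_) (δ-sym i l)) (sum-δ (λ l → A l zero) i)))
    first-column-expanded i (suc j) = sym (setCol-miss A {zero} {suc j} expanded i λ ())
    unit-first-column : ∀ l → f (setCol A zero (λ i → δ i l)) ≡ det (minor l A) * (sgn l * f I)
    unit-first-column l = begin
      f (setCol A zero (λ i → δ i l))   ≡⟨ clear-row f-am A l ⟩
      f (embed l (minor l A))           ≡⟨ det-unique (embed-alternatingMultilinear f-am l) (minor l A) ⟩
      det (minor l A) * f (embed l I)   ≡⟨ cong (det (minor l A) *_) (trans (cong-≗ (embed-I l)) (cycleMatrix-sign f-am l)) ⟩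
      det (minor l A) * (sgn l * f I)   ∎

module DeterminantLaws where

  open FiniteSums
  open Determinant
  open AlternatingForms
  open import Data.Nat using (ℕ; zero; suc)
  open import Data.Integer using (0ℤ; 1ℤ; _+_; _*_)
  open import Data.Integer.Properties using (*-identityˡ; *-identityʳ; *-zeroˡ; *-zeroʳ; *-comm)
  open import Data.Integer.Tactic.RingSolver using (solve-∀)
  open import Data.Fin using (Fin; zero; suc)
  open import Relation.Binary.PropositionalEquality
  open import Function using (_∘_)
  open import Data.Empty using (⊥-elim)

  private
    variable
      n : ℕ

  det-I : det (I {n}) ≡ 1ℤ
  det-I {zero}  = refl
  det-I {suc n} = begin
    det (I {suc n})             ≡⟨ sum-single zero off-diagonal ⟩
    1ℤ * (1ℤ * det (I {n}))     ≡⟨ *-identityˡ (1ℤ * det (I {n})) ⟩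
    1ℤ * det (I {n})            ≡⟨ *-identityˡ (det (I {n})) ⟩
    det (I {n})                 ≡⟨ det-I {n} ⟩
    1ℤ                          ∎
    where
    open ≡-Reasoning
    off-diagonal : (l : Fin (suc n)) → l ≢ zero → sgn l * (I l zero * det (minor l I)) ≡ 0ℤ
    off-diagonal zero    l≢0 = ⊥-elim (l≢0 refl)
    off-diagonal (suc l) _   = trans (cong (sgn (suc l) *_) (*-zeroˡ (det (minor (suc l) I)))) (*-zeroʳ (sgn (suc l)))

  det-ᵀ-cong : Cong (det {n} ∘ _ᵀ)
  det-ᵀ-cong A≗B = det-cong λ i j → A≗B j i

  det-ᵀ-linear : Linear (det {n} ∘ _ᵀ)
  det-ᵀ-linear k A B C c A≈B C≈B Ak =
    det-linear-row k (A ᵀ) (B ᵀ) (C ᵀ) c (λ i j → A≈B j i) (λ i j → C≈B j i) Ak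

  det-ᵀ-alternatingMultilinear : AlternatingMultilinear (det {n} ∘ _ᵀ)
  det-ᵀ-alternatingMultilinear = record
    { cong-≗      = det-ᵀ-cong
    ; linear      = det-ᵀ-linear
    ; alternating = alternating-from-adjacent det-ᵀ-cong det-ᵀ-linear
                      (λ A adj Ap≡Aq → det-adjacent-rows (A ᵀ) adj Ap≡Aq)
    }

  det-ᵀ : (A : Mat n) → det (A ᵀ) ≡ det A
  det-ᵀ {n} A = begin
    det (A ᵀ)             ≡⟨ det-unique det-ᵀ-alternatingMultilinear A ⟩
    det A * det (I {n} ᵀ) ≡⟨ cong (det A *_) (trans (det-cong {n} λ i j → δ-sym j i) (det-I {n})) ⟩
    det A * 1ℤ            ≡⟨ *-identityʳ (det A) ⟩
    det A                 ∎
    where open ≡-Reasoning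

  det-alternatingMultilinear : AlternatingMultilinear (det {n})
  det-alternatingMultilinear = record
    { cong-≗      = det-cong
    ; linear      = λ k A B C c A≈B C≈B Ak → begin
        det A                            ≡⟨ det-ᵀ A ⟨
        det (A ᵀ)                        ≡⟨ det-linear-row k (A ᵀ) (B ᵀ) (C ᵀ) c
                                              (λ i j → A≈B j i) (λ i j → C≈B j i) Ak ⟩
        c * det (B ᵀ) + det (C ᵀ)        ≡⟨ cong₂ (λ x y → c * x + y) (det-ᵀ B) (det-ᵀ C) ⟩
        c * det B + det C                ∎
    ; alternating = λ A p q p≢q Ap≡Aq → trans (sym (det-ᵀ A)) (det-ᵀ-alternating A p q p≢q Ap≡Aq)
    }
    where
    open ≡-Reasoning
    det-ᵀ-alternating = AlternatingMultilinear.alternating det-ᵀ-alternatingMultilinear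

  det-zero-row : (A : Mat n) (p : Fin n) → (∀ j → A p j ≡ 0ℤ) → det A ≡ 0ℤ
  det-zero-row A p Ap≡0 = linear-zero-column det-ᵀ-linear (A ᵀ) p Ap≡0

  infixl 7 _∙_

  _∙_ : Mat n → Mat n → Mat n
  (A ∙ B) i j = sum λ k → A i k * B k j

  det-∙ : (A B : Mat n) → det (A ∙ B) ≡ det A * det B
  det-∙ {n} A B = begin
    det (A ∙ B)          ≡⟨ det-unique f-am B ⟩
    det B * det (A ∙ I)  ≡⟨ cong (det B *_) (det-cong A∙I≗A) ⟩
    det B * det A        ≡⟨ *-comm (det B) (det A) ⟩
    det A * det B        ∎
    where
    open ≡-Reasoning
    open AlternatingMultilinear (det-alternatingMultilinear {n})
    A∙-cong : (X Y : Mat n) (i j : Fin n) → (∀ k → X k j ≡ Y k j) → (A ∙ X) i j ≡ (A ∙ Y) i j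
    A∙-cong X Y i j Xj≗Yj = sum-cong-≗ λ k → cong (A i k *_) (Xj≗Yj k)
    distrib : ∀ a c b d → a * (c * b + d) ≡ c * (a * b) + a * d
    distrib = solve-∀
    f-am : AlternatingMultilinear (λ X → det (A ∙ X))
    f-am = record
      { cong-≗      = λ {X} {Y} X≗Y → det-cong λ i j → A∙-cong X Y i j λ k → X≗Y k j
      ; linear      = λ k X Y Z c X≈Y Z≈Y Xk → linear k (A ∙ X) (A ∙ Y) (A ∙ Z) c
          (λ i j j≢k → A∙-cong X Y i j λ m → X≈Y m j j≢k)
          (λ i j j≢k → A∙-cong Z Y i j λ m → Z≈Y m j j≢k)
          (λ i → begin
            sum (λ m → A i m * X m k)                        ≡⟨ sum-cong-≗ (λ m → trans (cong (A i m *_) (Xk m))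
                                                                  (distrib (A i m) c (Y m k) (Z m k))) ⟩
            sum (λ m → c * (A i m * Y m k) + A i m * Z m k)  ≡⟨ ∑-distrib-+ (λ m → c * (A i m * Y m k))
                                                                               (λ m → A i m * Z m k) ⟩
            sum (λ m → c * (A i m * Y m k)) + (A ∙ Z) i k    ≡⟨ cong (_+ (A ∙ Z) i k)
                                                                     (*-distribˡ-sum c (λ m → A i m * Y m k)) ⟨
            c * (A ∙ Y) i k + (A ∙ Z) i k                    ∎)
      ; alternating = λ X p q p≢q Xp≡Xq →
          alternating (A ∙ X) p q p≢q λ i → sum-cong-≗ λ k → cong (A i k *_) (Xp≡Xq k)
      }
    A∙I≗A : ∀ i j → (A ∙ I) i j ≡ A i j
    A∙I≗A i j = sum-δ (A i) j

module Hadamard where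

  open FiniteSums
  open Determinant
  open AlternatingForms using (AlternatingMultilinear; linear-zero-column)
  open DeterminantLaws
  open import Data.Nat as ℕ using (ℕ; zero; suc)
  import Data.Nat.Properties as ℕ
  open import Data.Integer using (ℤ; +_; -[1+_]; 0ℤ; 1ℤ; _+_; _*_; -_; _^_; _≤_; _<_; +≤+; +<+; _≟_; ∣_∣)
  open import Data.Integer.Base using (nonNegative; positive)
  open import Data.Integer.Properties
  open import Data.Integer.Tactic.RingSolver using (solve-∀)
  open import Data.Fin using (Fin; zero; suc; punchIn; punchOut)
  open import Data.Fin.Properties using (punchIn-punchOut)
  open import Data.Sum using (inj₁; inj₂)
  open import Data.Empty using (⊥-elim)
  open import Function using (_∘_)
  open import Relation.Binary.PropositionalEquality
  open import Relation.Nullary using (yes; no)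

  private
    variable
      m n N : ℕ

  0≤i*i : ∀ i → 0ℤ ≤ i * i
  0≤i*i (+ n)    = subst (0ℤ ≤_) (pos-* n n) (+≤+ ℕ.z≤n)
  0≤i*i -[1+ n ] = +≤+ ℕ.z≤n

  i*i≡+∣i∣*∣i∣ : ∀ i → i * i ≡ + (∣ i ∣ ℕ.* ∣ i ∣)
  i*i≡+∣i∣*∣i∣ i = sym (trans (cong +_ (sym (abs-* i i))) (0≤i⇒+∣i∣≡i (0≤i*i i)))

  i*i≡0⇒i≡0 : ∀ i → i * i ≡ 0ℤ → i ≡ 0ℤ
  i*i≡0⇒i≡0 i i*i≡0 with i*j≡0⇒i≡0∨j≡0 i i*i≡0
  ... | inj₁ i≡0 = i≡0
  ... | inj₂ i≡0 = i≡0

  *-monoˡ-≤-0≤ : ∀ {c a b} → 0ℤ ≤ c → a ≤ b → c * a ≤ c * b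
  *-monoˡ-≤-0≤ {c} 0≤c = *-monoˡ-≤-nonNeg c {{nonNegative 0≤c}}

  0≤* : ∀ {a b} → 0ℤ ≤ a → 0ℤ ≤ b → 0ℤ ≤ a * b
  0≤* {a} 0≤a 0≤b = subst (_≤ a * _) (*-zeroʳ a) (*-monoˡ-≤-0≤ 0≤a 0≤b)

  0<* : ∀ {a b} → 0ℤ < a → 0ℤ < b → 0ℤ < a * b
  0<* {a} 0<a 0<b = subst (_< a * _) (*-zeroʳ a) (*-monoˡ-<-pos a {{positive 0<a}} 0<b)

  0<^ : ∀ {a} n → 0ℤ < a → 0ℤ < a ^ n
  0<^ zero    _   = +<+ (ℕ.s≤s ℕ.z≤n)
  0<^ (suc n) 0<a = 0<* 0<a (0<^ n 0<a)

  sum-nonneg : {f : Fin n → ℤ} → (∀ i → 0ℤ ≤ f i) → 0ℤ ≤ sum f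
  sum-nonneg {zero}  _    = ≤-refl
  sum-nonneg {suc n} 0≤f = +-mono-≤ (0≤f zero) (sum-nonneg (0≤f ∘ suc))

  term≤sum : {f : Fin n → ℤ} → (∀ i → 0ℤ ≤ f i) → ∀ i → f i ≤ sum f
  term≤sum {suc n} {f} 0≤f i = subst (f i ≤_) (sym (sum-remove {i = i} f))
    (i≤i+j (f i) _ {{nonNegative (sum-nonneg (0≤f ∘ punchIn i))}})

  sum-nonneg-zero : {f : Fin n → ℤ} → (∀ i → 0ℤ ≤ f i) → sum f ≡ 0ℤ → ∀ i → f i ≡ 0ℤ
  sum-nonneg-zero 0≤f sum≡0 i = ≤-antisym (subst (_ ≤_) sum≡0 (term≤sum 0≤f i)) (0≤f i)

  sum-mono-≤ : {f g : Fin n → ℤ} → (∀ i → f i ≤ g i) → sum f ≤ sum g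
  sum-mono-≤ {zero}  _   = ≤-refl
  sum-mono-≤ {suc n} f≤g = +-mono-≤ (f≤g zero) (sum-mono-≤ (f≤g ∘ suc))

  sum-const : (n : ℕ) (c : ℤ) → sum {n} (λ _ → c) ≡ + n * c
  sum-const zero    c = sym (*-zeroˡ c)
  sum-const (suc n) c = trans (cong (λ x → c + x) (sum-const n c)) (distrib (+ n) c)
    where
    distrib : ∀ n c → c + n * c ≡ (1ℤ + n) * c
    distrib = solve-∀

  ∏ : (Fin m → ℤ) → ℤ
  ∏ {zero}  f = 1ℤ
  ∏ {suc m} f = f zero * ∏ (f ∘ suc)

  ∏-nonneg : {f : Fin m → ℤ} → (∀ i → 0ℤ ≤ f i) → 0ℤ ≤ ∏ f
  ∏-nonneg {zero}  _   = +≤+ ℕ.z≤n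
  ∏-nonneg {suc m} 0≤f = 0≤* (0≤f zero) (∏-nonneg (0≤f ∘ suc))

  ∏-mono-≤ : {f g : Fin m → ℤ} → (∀ i → 0ℤ ≤ f i) → (∀ i → f i ≤ g i) → ∏ f ≤ ∏ g
  ∏-mono-≤ {zero}          _   _   = ≤-refl
  ∏-mono-≤ {suc m} {f} {g} 0≤f f≤g = begin
    f zero * ∏ (f ∘ suc)  ≤⟨ *-monoˡ-≤-0≤ (0≤f zero) (∏-mono-≤ (0≤f ∘ suc) (f≤g ∘ suc)) ⟩
    f zero * ∏ (g ∘ suc)  ≤⟨ *-monoʳ-≤-nonNeg (∏ (g ∘ suc)) {{nonNegative 0≤∏g}} (f≤g zero) ⟩
    g zero * ∏ (g ∘ suc)  ∎
    where
    open ≤-Reasoning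
    0≤∏g : 0ℤ ≤ ∏ (g ∘ suc)
    0≤∏g = ∏-nonneg λ i → ≤-trans (0≤f (suc i)) (f≤g (suc i))

  ∏-scale : (c : ℤ) (f : Fin m → ℤ) → ∏ (λ i → c * f i) ≡ c ^ m * ∏ f
  ∏-scale {zero}  c f = refl
  ∏-scale {suc m} c f = trans (cong (c * f zero *_) (∏-scale c (f ∘ suc)))
                              (interchange c (f zero) (c ^ m) (∏ (f ∘ suc)))
    where
    interchange : ∀ c x p q → c * x * (p * q) ≡ c * p * (x * q)
    interchange = solve-∀

  ∏-const : (c : ℤ) → ∏ {m} (λ _ → c) ≡ c ^ m
  ∏-const {zero}  c = refl
  ∏-const {suc m} c = cong (c *_) (∏-const {m} c)

  ^-square : (a : ℤ) (m : ℕ) → (a * a) ^ m ≡ a ^ m * a ^ m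
  ^-square a zero    = refl
  ^-square a (suc m) = trans (cong (a * a *_) (^-square a m)) (interchange a (a ^ m))
    where
    interchange : ∀ a p → a * a * (p * p) ≡ a * p * (a * p)
    interchange = solve-∀

  det-scale : (c : ℤ) (S : Mat n) → det (λ i j → c * S i j) ≡ c ^ n * det S
  det-scale {zero}  c S = refl
  det-scale {suc n} c S = begin
    sum (λ l → sgn l * (c * S l zero * det (λ i j → c * minor l S i j)))
      ≡⟨ sum-cong-≗ (λ l → cong (λ x → sgn l * (c * S l zero * x)) (det-scale c (minor l S))) ⟩
    sum (λ l → sgn l * (c * S l zero * (c ^ n * det (minor l S))))
      ≡⟨ sum-cong-≗ (λ l → pull-out (sgn l) c (S l zero) (c ^ n) (det (minor l S))) ⟩
    sum (λ l → c * c ^ n * (sgn l * (S l zero * det (minor l S))))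
      ≡⟨ *-distribˡ-sum (c * c ^ n) (λ l → sgn l * (S l zero * det (minor l S))) ⟨
    c * c ^ n * det S ∎
    where
    open ≡-Reasoning
    pull-out : ∀ s c x p d → s * (c * x * (p * d)) ≡ c * p * (s * (x * d))
    pull-out = solve-∀

  ⟨_,_⟩ : (Fin N → ℤ) → (Fin N → ℤ) → ℤ
  ⟨ u , v ⟩ = sum λ x → u x * v x

  ⟨⟩-comm : (u v : Fin N → ℤ) → ⟨ u , v ⟩ ≡ ⟨ v , u ⟩
  ⟨⟩-comm u v = sum-cong-≗ λ x → *-comm (u x) (v x)

  ⟨⟩-linearˡ : (c d : ℤ) (u w z : Fin N → ℤ) →
               ⟨ (λ x → c * u x + d * w x) , z ⟩ ≡ c * ⟨ u , z ⟩ + d * ⟨ w , z ⟩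
  ⟨⟩-linearˡ c d u w z = begin
    sum (λ x → (c * u x + d * w x) * z x)            ≡⟨ sum-cong-≗ (λ x → distrib c (u x) d (w x) (z x)) ⟩
    sum (λ x → c * (u x * z x) + d * (w x * z x))    ≡⟨ ∑-distrib-+ (λ x → c * (u x * z x)) (λ x → d * (w x * z x)) ⟩
    sum (λ x → c * (u x * z x)) + sum (λ x → d * (w x * z x))
      ≡⟨ cong₂ _+_ (*-distribˡ-sum c (λ x → u x * z x)) (*-distribˡ-sum d (λ x → w x * z x)) ⟨
    c * ⟨ u , z ⟩ + d * ⟨ w , z ⟩                   ∎
    where
    open ≡-Reasoning
    distrib : ∀ c u d w z → (c * u + d * w) * z ≡ c * (u * z) + d * (w * z)
    distrib = solve-∀

  ⟨⟩-linearʳ : (c d : ℤ) (z u w : Fin N → ℤ) →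
               ⟨ z , (λ x → c * u x + d * w x) ⟩ ≡ c * ⟨ z , u ⟩ + d * ⟨ z , w ⟩
  ⟨⟩-linearʳ c d z u w = trans (⟨⟩-comm z _) (trans (⟨⟩-linearˡ c d u w z)
    (cong₂ (λ x y → c * x + d * y) (⟨⟩-comm u z) (⟨⟩-comm w z)))

  0≤⟨u,u⟩ : (u : Fin N → ℤ) → 0ℤ ≤ ⟨ u , u ⟩
  0≤⟨u,u⟩ u = sum-nonneg λ x → 0≤i*i (u x)

  ⟨u,u⟩≤ : (u : Fin N → ℤ) (c : ℕ) → (∀ x → ∣ u x ∣ ℕ.≤ c) → ⟨ u , u ⟩ ≤ + (N ℕ.* (c ℕ.* c))
  ⟨u,u⟩≤ {N} u c ∣u∣≤c = begin
    sum (λ x → u x * u x)    ≤⟨ sum-mono-≤ (λ x → subst (_≤ + (c ℕ.* c)) (sym (i*i≡+∣i∣*∣i∣ (u x)))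
                                                       (+≤+ (ℕ.*-mono-≤ (∣u∣≤c x) (∣u∣≤c x)))) ⟩
    sum {N} (λ _ → + (c ℕ.* c))  ≡⟨ sum-const N (+ (c ℕ.* c)) ⟩
    + N * + (c ℕ.* c)        ≡⟨ pos-* N (c ℕ.* c) ⟨
    + (N ℕ.* (c ℕ.* c))      ∎
    where open ≤-Reasoning

  Gram : (Fin m → Fin N → ℤ) → Mat m
  Gram r i j = ⟨ r i , r j ⟩

  module GramSchmidtStep (r : Fin (suc m) → Fin N → ℤ) where

    a : ℤ
    a = ⟨ r zero , r zero ⟩

    v : Fin m → ℤ
    v k = ⟨ r (suc k) , r zero ⟩

    -- q k is r (suc k) made orthogonal to r zero, scaled by a to stay integral; right
    -- multiplication by E below performs the same operation on the columns of the Gram matrix.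
    q : Fin m → Fin N → ℤ
    q k x = a * r (suc k) x + - v k * r zero x

    S : Mat m
    S k l = a * Gram r (suc k) (suc l) + - v k * v l

    Gram-q : ∀ k l → Gram q k l ≡ a * S k l
    Gram-q k l = begin
      ⟨ q k , q l ⟩                                   ≡⟨ ⟨⟩-linearˡ a (- v k) (r (suc k)) (r zero) (q l) ⟩
      a * ⟨ r (suc k) , q l ⟩ + - v k * ⟨ r zero , q l ⟩
        ≡⟨ cong₂ (λ x y → a * x + - v k * y) (⟨⟩-linearʳ a (- v l) (r (suc k)) (r (suc l)) (r zero))
                                             (⟨⟩-linearʳ a (- v l) (r zero) (r (suc l)) (r zero)) ⟩
      a * (a * Gram r (suc k) (suc l) + - v l * v k) + - v k * (a * ⟨ r zero , r (suc l) ⟩ + - v l * a)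
        ≡⟨ cong (λ y → a * (a * Gram r (suc k) (suc l) + - v l * v k) + - v k * (a * y + - v l * a))
                (⟨⟩-comm (r zero) (r (suc l))) ⟩
      a * (a * Gram r (suc k) (suc l) + - v l * v k) + - v k * (a * v l + - v l * a)
        ≡⟨ simplify a (Gram r (suc k) (suc l)) (v k) (v l) ⟩
      a * S k l                                       ∎
      where
      open ≡-Reasoning
      simplify : ∀ a g x y → a * (a * g + - y * x) + - x * (a * y + - y * a) ≡ a * (a * g + - x * y)
      simplify = solve-∀

    E : Mat (suc m)
    E i       zero    = δ i zero
    E zero    (suc l) = - v l
    E (suc k) (suc l) = a * δ k l

    det-E : det E ≡ a ^ m
    det-E = begin
      det E                           ≡⟨ sum-single zero off-diagonal ⟩
      1ℤ * (1ℤ * det (minor zero E))  ≡⟨ trans (*-identityˡ _) (*-identityˡ (det (minor zero E))) ⟩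
      det (λ k l → a * I {m} k l)     ≡⟨ det-scale a (I {m}) ⟩
      a ^ m * det (I {m})             ≡⟨ cong (a ^ m *_) (det-I {m}) ⟩
      a ^ m * 1ℤ                      ≡⟨ *-identityʳ (a ^ m) ⟩
      a ^ m                           ∎
      where
      open ≡-Reasoning
      off-diagonal : (l : Fin (suc m)) → l ≢ zero → sgn l * (E l zero * det (minor l E)) ≡ 0ℤ
      off-diagonal zero    l≢0 = ⊥-elim (l≢0 refl)
      off-diagonal (suc l) _   = trans (cong (sgn (suc l) *_) (*-zeroˡ (det (minor (suc l) E)))) (*-zeroʳ (sgn (suc l)))

    G∙E-zero : ∀ i → (Gram r ∙ E) i zero ≡ Gram r i zero
    G∙E-zero i = trans (sum-cong-≗ λ k → cong (Gram r i k *_) (δ-sym k zero)) (sum-δ (Gram r i) zero)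

    G∙E-suc : ∀ i l → (Gram r ∙ E) i (suc l) ≡ - v l * Gram r i zero + a * Gram r i (suc l)
    G∙E-suc i l = cong₂ _+_ (*-comm (Gram r i zero) (- v l)) (begin
      sum (λ k → Gram r i (suc k) * (a * δ k l))  ≡⟨ sum-cong-≗ (λ k → rearrange (Gram r i (suc k)) a (δ k l)) ⟩
      sum (λ k → a * (Gram r i (suc k) * δ k l))  ≡⟨ *-distribˡ-sum a (λ k → Gram r i (suc k) * δ k l) ⟨
      a * sum (λ k → Gram r i (suc k) * δ k l)    ≡⟨ cong (a *_) (sum-δ (λ k → Gram r i (suc k)) l) ⟩
      a * Gram r i (suc l)                        ∎)
      where
      open ≡-Reasoning
      rearrange : ∀ g a d → g * (a * d) ≡ a * (g * d)
      rearrange = solve-∀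

    det-G∙E : det (Gram r ∙ E) ≡ a * det S
    det-G∙E = begin
      det (Gram r ∙ E)                                        ≡⟨ sum-single zero off-diagonal ⟩
      1ℤ * ((Gram r ∙ E) zero zero * det (minor zero (Gram r ∙ E)))
        ≡⟨ *-identityˡ _ ⟩
      (Gram r ∙ E) zero zero * det (minor zero (Gram r ∙ E))  ≡⟨ cong₂ _*_ (G∙E-zero zero) (det-cong minor-S) ⟩
      a * det S                                               ∎
      where
      open ≡-Reasoning
      minor-S : ∀ k l → (Gram r ∙ E) (suc k) (suc l) ≡ S k l
      minor-S k l = trans (G∙E-suc (suc k) l) (swap-terms (v l) (v k) a (Gram r (suc k) (suc l)))
        where
        swap-terms : ∀ x y a g → - x * y + a * g ≡ a * g + - y * x
        swap-terms = solve-∀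
      first-row-vanishes : ∀ l → (Gram r ∙ E) zero (suc l) ≡ 0ℤ
      first-row-vanishes l = begin
        (Gram r ∙ E) zero (suc l)                ≡⟨ G∙E-suc zero l ⟩
        - v l * a + a * ⟨ r zero , r (suc l) ⟩   ≡⟨ cong (λ y → - v l * a + a * y) (⟨⟩-comm (r zero) (r (suc l))) ⟩
        - v l * a + a * v l                      ≡⟨ cancel (v l) a ⟩
        0ℤ                                       ∎
        where
        cancel : ∀ x a → - x * a + a * x ≡ 0ℤ
        cancel = solve-∀
      off-diagonal : (i : Fin (suc m)) → i ≢ zero →
                     sgn i * ((Gram r ∙ E) i zero * det (minor i (Gram r ∙ E))) ≡ 0ℤ
      off-diagonal zero    i≢0 = ⊥-elim (i≢0 refl)
      off-diagonal (suc i) _   = begin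
        sgn (suc i) * ((Gram r ∙ E) (suc i) zero * det (minor (suc i) (Gram r ∙ E)))
          ≡⟨ cong (λ x → sgn (suc i) * ((Gram r ∙ E) (suc i) zero * x))
                  (det-zero-row (minor (suc i) (Gram r ∙ E)) (punchOut 1+i≢0) λ l →
                     trans (cong (λ x → (Gram r ∙ E) x (suc l)) (punchIn-punchOut 1+i≢0)) (first-row-vanishes l)) ⟩
        sgn (suc i) * ((Gram r ∙ E) (suc i) zero * 0ℤ)
          ≡⟨ cong (sgn (suc i) *_) (*-zeroʳ ((Gram r ∙ E) (suc i) zero)) ⟩
        sgn (suc i) * 0ℤ
          ≡⟨ *-zeroʳ (sgn (suc i)) ⟩
        0ℤ ∎
        where
        1+i≢0 : suc i ≢ zero
        1+i≢0 ()

    scaled-Gram-det : a * det (Gram q) ≡ a ^ m * (a ^ m * det (Gram r))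
    scaled-Gram-det = begin
      a * det (Gram q)                    ≡⟨ cong (a *_) (trans (det-cong Gram-q) (det-scale a S)) ⟩
      a * (a ^ m * det S)                 ≡⟨ swap-front a (a ^ m) (det S) ⟩
      a ^ m * (a * det S)                 ≡⟨ cong (a ^ m *_) det-G∙E ⟨
      a ^ m * det (Gram r ∙ E)            ≡⟨ cong (a ^ m *_) (det-∙ (Gram r) E) ⟩
      a ^ m * (det (Gram r) * det E)      ≡⟨ cong (λ x → a ^ m * (det (Gram r) * x)) det-E ⟩
      a ^ m * (det (Gram r) * a ^ m)      ≡⟨ cong (a ^ m *_) (*-comm (det (Gram r)) (a ^ m)) ⟩
      a ^ m * (a ^ m * det (Gram r))      ∎
      where
      open ≡-Reasoning
      swap-front : ∀ x y z → x * (y * z) ≡ y * (x * z)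
      swap-front = solve-∀

  Gram-det≤∏ : (r : Fin m → Fin N → ℤ) → det (Gram r) ≤ ∏ (λ i → ⟨ r i , r i ⟩)
  Gram-det≤∏ {zero}  r = ≤-refl
  Gram-det≤∏ {suc m} r with ⟨ r zero , r zero ⟩ ≟ 0ℤ
  ... | yes ‖r₀‖²≡0 = begin
    det (Gram r)                        ≡⟨ linear-zero-column det-linear (Gram r) zero first-column-vanishes ⟩
    0ℤ                                  ≤⟨ ∏-nonneg (λ i → 0≤⟨u,u⟩ (r i)) ⟩
    ∏ (λ i → ⟨ r i , r i ⟩)             ∎
    where
    open ≤-Reasoning
    det-linear = AlternatingMultilinear.linear (det-alternatingMultilinear {suc m})
    r₀≡0 : ∀ x → r zero x ≡ 0ℤ
    r₀≡0 x = i*i≡0⇒i≡0 (r zero x) (sum-nonneg-zero (λ x → 0≤i*i (r zero x)) ‖r₀‖²≡0 x)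
    first-column-vanishes : ∀ i → Gram r i zero ≡ 0ℤ
    first-column-vanishes i = sum-zero λ x → trans (cong (r i x *_) (r₀≡0 x)) (*-zeroʳ (r i x))
  ... | no ‖r₀‖²≢0 = *-cancelˡ-≤-pos _ _ (a ^ m * a ^ m) {{positive (0<* (0<^ m 0<a) (0<^ m 0<a))}} bound
    where
    open GramSchmidtStep r
    open ≤-Reasoning
    0<a : 0ℤ < a
    0<a = ≤∧≢⇒< (0≤⟨u,u⟩ (r zero)) (‖r₀‖²≢0 ∘ sym)
    ∏′ : ℤ
    ∏′ = ∏ (λ k → ⟨ r (suc k) , r (suc k) ⟩)
    ‖q‖²≤ : ∀ k → ⟨ q k , q k ⟩ ≤ a * a * ⟨ r (suc k) , r (suc k) ⟩
    ‖q‖²≤ k = begin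
      ⟨ q k , q k ⟩                                           ≡⟨ Gram-q k k ⟩
      a * S k k                                               ≡⟨ expand a (Gram r (suc k) (suc k)) (v k) ⟩
      a * a * Gram r (suc k) (suc k) + - (a * (v k * v k))    ≤⟨ +-monoʳ-≤ (a * a * Gram r (suc k) (suc k))
                                                                   (neg-mono-≤ (0≤* (<⇒≤ 0<a) (0≤i*i (v k)))) ⟩
      a * a * Gram r (suc k) (suc k) + 0ℤ                     ≡⟨ +-identityʳ _ ⟩
      a * a * Gram r (suc k) (suc k)                          ∎
      where
      expand : ∀ a g x → a * (a * g + - x * x) ≡ a * a * g + - (a * (x * x))
      expand = solve-∀
    bound : a ^ m * a ^ m * det (Gram r) ≤ a ^ m * a ^ m * (a * ∏′)
    bound = begin
      a ^ m * a ^ m * det (Gram r)                        ≡⟨ trans (*-assoc (a ^ m) (a ^ m) _) (sym scaled-Gram-det) ⟩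
      a * det (Gram q)                                    ≤⟨ *-monoˡ-≤-0≤ (<⇒≤ 0<a) (Gram-det≤∏ q) ⟩
      a * ∏ (λ k → ⟨ q k , q k ⟩)                         ≤⟨ *-monoˡ-≤-0≤ (<⇒≤ 0<a)
                                                               (∏-mono-≤ (λ k → 0≤⟨u,u⟩ (q k)) ‖q‖²≤) ⟩
      a * ∏ (λ k → a * a * ⟨ r (suc k) , r (suc k) ⟩)     ≡⟨ cong (a *_) (∏-scale (a * a) (λ k → ⟨ r (suc k) , r (suc k) ⟩)) ⟩
      a * ((a * a) ^ m * ∏′)                              ≡⟨ cong (λ x → a * (x * ∏′)) (^-square a m) ⟩
      a * (a ^ m * a ^ m * ∏′)                            ≡⟨ swap-front a (a ^ m * a ^ m) ∏′ ⟩
      a ^ m * a ^ m * (a * ∏′)                            ∎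
      where
      swap-front : ∀ x y z → x * (y * z) ≡ y * (x * z)
      swap-front = solve-∀

  hadamard : (D : Mat n) → det D * det D ≤ ∏ (λ i → ⟨ D i , D i ⟩)
  hadamard D = begin
    det D * det D          ≡⟨ cong (det D *_) (det-ᵀ D) ⟨
    det D * det (D ᵀ)      ≡⟨ det-∙ D (D ᵀ) ⟨
    det (D ∙ D ᵀ)          ≤⟨ Gram-det≤∏ D ⟩
    ∏ (λ i → ⟨ D i , D i ⟩) ∎
    where open ≤-Reasoning

module NonsingularSubmatrix where

  open FiniteSums
  open Determinant
  open import Data.Nat using (ℕ; zero; suc)
  open import Data.Integer using (ℤ; 0ℤ; _+_; _*_; _≟_)
  open import Data.Integer.Properties using (*-zeroˡ; +-identityˡ; *-identityˡ)
  open import Data.Integer.Tactic.RingSolver using (solve-∀)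
  open import Data.Fin using (Fin; zero; suc; punchIn)
  open import Data.Fin.Properties using (all?; ¬∀⟶∃¬)
  open import Data.Vec.Functional using (_∷_)
  open import Data.Product using (Σ-syntax; ∃; _×_; _,_)
  open import Data.Sum using (_⊎_; inj₁; inj₂)
  open import Function using (_∘_)
  open import Relation.Binary.PropositionalEquality
  open import Relation.Nullary using (yes; no)

  private
    variable
      k t : ℕ

  RowDependent : (Fin k → Fin t → ℤ) → Set
  RowDependent {k} N = Σ[ c ∈ (Fin k → ℤ) ] (∀ j → sum (λ i → c i * N i j) ≡ 0ℤ) × ∃ λ i → c i ≢ 0ℤ

  columns : (Fin k → Fin t → ℤ) → (Fin k → Fin t) → Mat k
  columns N σ i l = N i (σ l)

  dependent-or-nonsingular : (N : Fin k → Fin t → ℤ) →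
                             RowDependent N ⊎ Σ[ σ ∈ (Fin k → Fin t) ] det (columns N σ) ≢ 0ℤ
  dependent-or-nonsingular {zero}  N = inj₂ ((λ ()) , λ ())
  dependent-or-nonsingular {suc k} {t} N with dependent-or-nonsingular (N ∘ suc)
  ... | inj₁ (c , c-dependent , i , cᵢ≢0) = inj₁ ((0ℤ ∷ c) , extended , suc i , cᵢ≢0)
    where
    extended : ∀ j → 0ℤ * N zero j + sum (λ i → c i * N (suc i) j) ≡ 0ℤ
    extended j = trans (cong (_+ sum (λ i → c i * N (suc i) j)) (*-zeroˡ (N zero j)))
                       (trans (+-identityˡ _) (c-dependent j))
  ... | inj₂ (σ , det≢0) with all? (λ j → det (columns N (j ∷ σ)) ≟ 0ℤ)
  ...   | no some-nonzero with ¬∀⟶∃¬ t _ (λ j → det (columns N (j ∷ σ)) ≟ 0ℤ) some-nonzero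
  ...     | j , det≢0′ = inj₂ ((j ∷ σ) , det≢0′)
  dependent-or-nonsingular {suc k} {t} N
      | inj₂ (σ , det≢0) | yes all-zero = inj₁ (cofactor , dependent , zero , cofactor₀≢0)
    where
    cofactor-minor : Fin (suc k) → Mat k
    cofactor-minor i i′ l = N (punchIn i i′) (σ l)
    cofactor : Fin (suc k) → ℤ
    cofactor i = sgn i * det (cofactor-minor i)
    reorder : ∀ s d x → s * d * x ≡ s * (x * d)
    reorder = solve-∀
    dependent : ∀ j → sum (λ i → cofactor i * N i j) ≡ 0ℤ
    dependent j = trans (sum-cong-≗ λ i → reorder (sgn i) (det (cofactor-minor i)) (N i j)) (all-zero j)
    cofactor₀≢0 : cofactor zero ≢ 0ℤ
    cofactor₀≢0 eq = det≢0 (trans (sym (*-identityˡ (det (cofactor-minor zero)))) eq)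

  scatter : (Fin k → Fin t) → (Fin k → ℤ) → Fin t → ℤ
  scatter σ y j = sum λ l → y l * δ j (σ l)

  mulVec-scatter : ∀ {r k t} (N : Matrix r t) (σ : Fin k → Fin t) (y : Fin k → ℤ) (i : Fin r) →
                   mulVec N (scatter σ y) i ≡ sum (λ l → N i (σ l) * y l)
  mulVec-scatter {r} {k} {t} N σ y i = begin
    Σℤ t (λ j → N i j * scatter σ y j)                  ≡⟨ Σℤ≡sum t _ ⟩
    sum (λ j → N i j * sum (λ l → y l * δ j (σ l)))     ≡⟨ sum-cong-≗ (λ j → *-distribˡ-sum (N i j) (scatter-term j)) ⟩
    sum (λ j → sum (λ l → N i j * (y l * δ j (σ l))))   ≡⟨ ∑-comm (λ j l → N i j * (y l * δ j (σ l))) ⟩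
    sum (λ l → sum (λ j → N i j * (y l * δ j (σ l))))   ≡⟨ sum-cong-≗ (λ l → trans
                                                             (sum-cong-≗ λ j → reorder (N i j) (y l) (δ j (σ l)))
                                                             (sym (*-distribʳ-sum (y l) (λ j → N i j * δ j (σ l))))) ⟩
    sum (λ l → sum (λ j → N i j * δ j (σ l)) * y l)     ≡⟨ sum-cong-≗ (λ l → cong (_* y l) (sum-δ (N i) (σ l))) ⟩
    sum (λ l → N i (σ l) * y l)                         ∎
    where
    open ≡-Reasoning
    scatter-term : Fin t → Fin k → ℤ
    scatter-term j l = y l * δ j (σ l)
    reorder : ∀ n y d → n * (y * d) ≡ n * d * y
    reorder = solve-∀

  nonsingular-columns : (N : Fin k → Fin t → ℤ) → HasFullRowRank N →
                        Σ[ σ ∈ (Fin k → Fin t) ] det (columns N σ) ≢ 0ℤ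
  nonsingular-columns {k} N full-rank with dependent-or-nonsingular N
  ... | inj₂ nonsingular                    = nonsingular
  ... | inj₁ (c , c-dependent , i , cᵢ≢0) with () ← cᵢ≢0 (full-rank c (λ j → trans (Σℤ≡sum k _) (c-dependent j)) i)

module Cramer where

  open FiniteSums
  open Determinant
  open AlternatingForms using (AlternatingMultilinear)
  open DeterminantLaws
  open Hadamard
  open import Data.Nat as ℕ using (ℕ; zero; suc)
  open import Data.Integer using (ℤ; +_; 0ℤ; 1ℤ; _+_; _*_; -_; _^_; _≤_; _<_; ∣_∣)
  import Data.Nat.Properties as ℕ
  open import Data.Integer.Properties
    using (+-identityʳ; *-identityˡ; pos-*; drop‿+≤+; <-cmp; -1*i≡-i; neg-mono-<; module ≤-Reasoning)
  open import Data.Product using (Σ-syntax; _×_; _,_)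
  open import Data.Empty using (⊥-elim)
  open import Relation.Binary.Definitions using (tri<; tri≈; tri>)
  open import Data.Integer.Tactic.RingSolver using (solve-∀)
  open import Data.Fin using (Fin; zero; suc; punchIn)
  open import Relation.Binary.PropositionalEquality

  unit-making-positive : {d : ℤ} → d ≢ 0ℤ → Σ[ ε ∈ ℤ ] ∣ ε ∣ ≡ 1 × 0ℤ < ε * d
  unit-making-positive {d} d≢0 with <-cmp 0ℤ d
  ... | tri< 0<d _ _ = 1ℤ , refl , subst (0ℤ <_) (sym (*-identityˡ d)) 0<d
  ... | tri≈ _ 0≡d _ = ⊥-elim (d≢0 (sym 0≡d))
  ... | tri> _ _ d<0 = - 1ℤ , refl , subst (0ℤ <_) (sym (-1*i≡-i d)) (neg-mono-< d<0)

  sgn² : ∀ {n} (i : Fin n) → sgn i * sgn i ≡ 1ℤ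
  sgn² zero    = refl
  sgn² (suc i) = trans (neg-square (sgn i)) (sgn² i)
    where
    neg-square : ∀ x → - x * - x ≡ x * x
    neg-square = solve-∀

  module _ {s : ℕ} (B : Mat s) where

    K : Fin (suc s) → Fin s → ℤ
    K zero    j = - 1ℤ
    K (suc k) j = B j k

    cofactorMatrix : Fin s → Mat s
    cofactorMatrix k i j = K (punchIn (suc k) i) j

    adj𝟙 : Fin s → ℤ
    adj𝟙 k = sgn (suc k) * det (cofactorMatrix k)

    -- W has equal columns zero and suc i; expanding det W along its first column gives
    -- 0 = - det Bᵀ + Σ_k B i k (adj𝟙 k).
    B∙adj𝟙≡det : ∀ i → sum (λ k → B i k * adj𝟙 k) ≡ det B
    B∙adj𝟙≡det i = begin
      sum (λ k → B i k * adj𝟙 k)             ≡⟨ sum-cong-≗ (λ k → reorder (B i k) (sgn (suc k)) (det (cofactorMatrix k))) ⟩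
      rest                                ≡⟨ split-off (det (B ᵀ)) rest ⟩
      det (B ᵀ) + det W                   ≡⟨ cong (λ y → det (B ᵀ) + y) det-W≡0 ⟩
      det (B ᵀ) + 0ℤ                      ≡⟨ +-identityʳ (det (B ᵀ)) ⟩
      det (B ᵀ)                           ≡⟨ det-ᵀ B ⟩
      det B                               ∎
      where
      open ≡-Reasoning
      W : Mat (suc s)
      W r zero    = K r i
      W r (suc j) = K r j
      det-W≡0 : det W ≡ 0ℤ
      det-W≡0 = AlternatingMultilinear.alternating det-alternatingMultilinear W zero (suc i) (λ ()) (λ r → refl)
      rest : ℤ
      rest = sum (λ k → sgn (suc k) * (B i k * det (cofactorMatrix k)))
      reorder : ∀ b s d → b * (s * d) ≡ s * (b * d)
      reorder = solve-∀
      split-off : ∀ d r → r ≡ d + (1ℤ * (- 1ℤ * d) + r)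
      split-off = solve-∀

    B∙εadj𝟙≡ε*det : (ε : ℤ) → ∀ i → sum (λ k → B i k * (ε * adj𝟙 k)) ≡ ε * det B
    B∙εadj𝟙≡ε*det ε i = begin
      sum (λ k → B i k * (ε * adj𝟙 k))   ≡⟨ sum-cong-≗ (λ k → swap-front (B i k) ε (adj𝟙 k)) ⟩
      sum (λ k → ε * (B i k * adj𝟙 k))   ≡⟨ *-distribˡ-sum ε (λ k → B i k * adj𝟙 k) ⟨
      ε * sum (λ k → B i k * adj𝟙 k)     ≡⟨ cong (ε *_) (B∙adj𝟙≡det i) ⟩
      ε * det B                       ∎
      where
      open ≡-Reasoning
      swap-front : ∀ a b c → a * (b * c) ≡ b * (a * c)
      swap-front = solve-∀

  pos-^ : (a n : ℕ) → + (a ℕ.^ n) ≡ (+ a) ^ n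
  pos-^ a zero    = refl
  pos-^ a (suc n) = trans (pos-* a (a ℕ.^ n)) (cong (+ a *_) (pos-^ a n))

  module _ {s′ : ℕ} (B : Mat (suc s′)) (A : ℕ) (∣B∣≤A : ∀ i j → ∣ B i j ∣ ℕ.≤ A) where

    private
      s = suc s′

    ∣adj𝟙∣²≤ : ∀ k → ∣ adj𝟙 B k ∣ ℕ.* ∣ adj𝟙 B k ∣ ℕ.≤ s ℕ.* (s ℕ.* (A ℕ.* A)) ℕ.^ s′
    ∣adj𝟙∣²≤ k = drop‿+≤+ (begin
      + (∣ adj𝟙 B k ∣ ℕ.* ∣ adj𝟙 B k ∣)           ≡⟨ i*i≡+∣i∣*∣i∣ (adj𝟙 B k) ⟨
      adj𝟙 B k * adj𝟙 B k                          ≡⟨ square-product (sgn (suc k)) (det C) ⟩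
      sgn (suc k) * sgn (suc k) * (det C * det C)
                                             ≡⟨ trans (cong (_* (det C * det C)) (sgn² (suc k))) (*-identityˡ _) ⟩
      det C * det C                          ≤⟨ hadamard C ⟩
      ∏ (λ i → ⟨ C i , C i ⟩)                ≤⟨ ∏-mono-≤ (λ i → 0≤⟨u,u⟩ (C i)) row-bound ⟩
      ∏ row-norm-bound                       ≡⟨⟩
      + s * ∏ {s′} (λ _ → + (s ℕ.* (A ℕ.* A))) ≡⟨ cong (+ s *_) (∏-const {s′} (+ (s ℕ.* (A ℕ.* A)))) ⟩
      + s * (+ (s ℕ.* (A ℕ.* A))) ^ s′      ≡⟨ trans (pos-* s _) (cong (+ s *_) (pos-^ _ s′)) ⟨
      + (s ℕ.* (s ℕ.* (A ℕ.* A)) ℕ.^ s′)   ∎)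
      where
      open ≤-Reasoning
      C = cofactorMatrix B k
      square-product : ∀ a b → a * b * (a * b) ≡ a * a * (b * b)
      square-product = solve-∀
      row-norm-bound : Fin s → ℤ
      row-norm-bound zero    = + s
      row-norm-bound (suc _) = + (s ℕ.* (A ℕ.* A))
      row-bound : ∀ i → ⟨ C i , C i ⟩ ≤ row-norm-bound i
      row-bound zero    = subst (⟨ C zero , C zero ⟩ ≤_) (cong +_ (ℕ.*-identityʳ s))
                                (⟨u,u⟩≤ (C zero) 1 (λ _ → ℕ.≤-refl))
      row-bound (suc i) = ⟨u,u⟩≤ (C (suc i)) A (λ j → ∣B∣≤A j (punchIn k i))

module ℓ₁Bounds where

  open FiniteSums
  open NonsingularSubmatrix using (scatter)
  open import Data.Nat using (ℕ; zero; suc; _≤_; _+_; _*_; _^_; _⊔_; z≤n)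
  open import Data.Nat.Properties
    using (≤-reflexive; ≤-trans; +-mono-≤; *-mono-≤; *-monoʳ-≤; *-zeroʳ; +-identityʳ; m≤m⊔n; m≤n⊔m; ⊔-sel;
           ^-distribˡ-+-*; module ≤-Reasoning)
  open import Data.Nat.Tactic.RingSolver using (solve-∀)
  open import Data.Integer as ℤ using (ℤ; ∣_∣)
  import Data.Integer.Properties as ℤ
  open import Data.Fin using (Fin; zero; suc)
  open import Data.Sum using (inj₁; inj₂)
  open import Function using (_∘_)
  open import Relation.Binary.PropositionalEquality

  private
    variable
      n r t : ℕ

  Σℕ-cong : {f g : Fin n → ℕ} → (∀ i → f i ≡ g i) → Σℕ n f ≡ Σℕ n g
  Σℕ-cong {zero}  _   = refl
  Σℕ-cong {suc n} f≗g = cong₂ _+_ (f≗g zero) (Σℕ-cong (f≗g ∘ suc))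

  Σℕ-mono-≤ : {f g : Fin n → ℕ} → (∀ i → f i ≤ g i) → Σℕ n f ≤ Σℕ n g
  Σℕ-mono-≤ {zero}  _   = z≤n
  Σℕ-mono-≤ {suc n} f≤g = +-mono-≤ (f≤g zero) (Σℕ-mono-≤ (f≤g ∘ suc))

  Σℕ-+ : (f g : Fin n → ℕ) → Σℕ n (λ i → f i + g i) ≡ Σℕ n f + Σℕ n g
  Σℕ-+ {zero}  f g = refl
  Σℕ-+ {suc n} f g = trans (cong (f zero + g zero +_) (Σℕ-+ (f ∘ suc) (g ∘ suc)))
                           (interchange (f zero) (g zero) (Σℕ n (f ∘ suc)) (Σℕ n (g ∘ suc)))
    where
    interchange : ∀ a b c d → a + b + (c + d) ≡ a + c + (b + d)
    interchange = solve-∀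

  Σℕ-const : (n c : ℕ) → Σℕ n (λ _ → c) ≡ n * c
  Σℕ-const zero    c = refl
  Σℕ-const (suc n) c = cong (c +_) (Σℕ-const n c)

  norm1-+ : (u v : Fin t → ℤ) → norm1 (λ j → u j ℤ.+ v j) ≤ norm1 u + norm1 v
  norm1-+ u v = ≤-trans (Σℕ-mono-≤ λ j → ℤ.∣i+j∣≤∣i∣+∣j∣ (u j) (v j))
                        (≤-reflexive (Σℕ-+ (λ j → ∣ u j ∣) (λ j → ∣ v j ∣)))

  norm1-unit : (c : ℤ) (p : Fin t) → norm1 (λ j → c ℤ.* δ j p) ≡ ∣ c ∣
  norm1-unit {suc t} c zero = begin
    ∣ c ℤ.* ℤ.1ℤ ∣ + Σℕ t (λ j → ∣ c ℤ.* ℤ.0ℤ ∣)  ≡⟨ cong₂ _+_ (cong ∣_∣ (ℤ.*-identityʳ c))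
                                                        (trans (Σℕ-cong {t} λ j → cong ∣_∣ (ℤ.*-zeroʳ c)) (Σℕ-const t 0)) ⟩
    ∣ c ∣ + t * 0                                  ≡⟨ cong (∣ c ∣ +_) (*-zeroʳ t) ⟩
    ∣ c ∣ + 0                                      ≡⟨ +-identityʳ ∣ c ∣ ⟩
    ∣ c ∣                                          ∎
    where open ≡-Reasoning
  norm1-unit {suc t} c (suc p) = cong₂ _+_ (cong ∣_∣ (ℤ.*-zeroʳ c)) (norm1-unit c p)

  norm1-scatter : (σ : Fin r → Fin t) (y : Fin r → ℤ) → norm1 (scatter σ y) ≤ Σℕ r (λ k → ∣ y k ∣)
  norm1-scatter {zero} {t} σ y = ≤-reflexive (trans (Σℕ-const t 0) (*-zeroʳ t))
  norm1-scatter {suc r} σ y = begin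
    norm1 (scatter σ y)                                      ≤⟨ norm1-+ (λ j → y zero ℤ.* δ j (σ zero)) _ ⟩
    norm1 (λ j → y zero ℤ.* δ j (σ zero)) + norm1 (scatter (σ ∘ suc) (y ∘ suc))
                                                             ≤⟨ +-mono-≤ (≤-reflexive (norm1-unit (y zero) (σ zero)))
                                                                         (norm1-scatter (σ ∘ suc) (y ∘ suc)) ⟩
    ∣ y zero ∣ + Σℕ r (λ k → ∣ y (suc k) ∣)                  ∎
    where open ≤-Reasoning

  ⨆ : (Fin n → ℕ) → ℕ
  ⨆ {zero}  u = 0
  ⨆ {suc n} u = u zero ⊔ ⨆ (u ∘ suc)

  ≤⨆ : (u : Fin n → ℕ) (i : Fin n) → u i ≤ ⨆ u
  ≤⨆ u zero    = m≤m⊔n (u zero) (⨆ (u ∘ suc))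
  ≤⨆ u (suc i) = ≤-trans (≤⨆ (u ∘ suc) i) (m≤n⊔m (u zero) (⨆ (u ∘ suc)))

  ⨆-square≤ : {X : ℕ} (u : Fin n → ℕ) → (∀ i → u i * u i ≤ X) → ⨆ u * ⨆ u ≤ X
  ⨆-square≤ {zero}  u _  = z≤n
  ⨆-square≤ {suc n} u u²≤X with ⊔-sel (u zero) (⨆ (u ∘ suc))
  ... | inj₁ ⨆≡u₀ rewrite ⨆≡u₀ = u²≤X zero
  ... | inj₂ ⨆≡⨆′ rewrite ⨆≡⨆′ = ⨆-square≤ (u ∘ suc) (u²≤X ∘ suc)

  Σℕ-square≤ : {X : ℕ} (u : Fin n → ℕ) → (∀ i → u i * u i ≤ X) → Σℕ n u * Σℕ n u ≤ n * (n * X)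
  Σℕ-square≤ {n} {X} u u²≤X = begin
    Σℕ n u * Σℕ n u          ≤⟨ *-mono-≤ Σu≤n⨆u Σu≤n⨆u ⟩
    n * ⨆ u * (n * ⨆ u)      ≡⟨ rearrange n (⨆ u) ⟩
    n * (n * (⨆ u * ⨆ u))    ≤⟨ *-monoʳ-≤ n (*-monoʳ-≤ n (⨆-square≤ u u²≤X)) ⟩
    n * (n * X)              ∎
    where
    open ≤-Reasoning
    Σu≤n⨆u : Σℕ n u ≤ n * ⨆ u
    Σu≤n⨆u = ≤-trans (Σℕ-mono-≤ (≤⨆ u)) (≤-reflexive (Σℕ-const n (⨆ u)))
    rearrange : ∀ n m → n * m * (n * m) ≡ n * (n * (m * m))
    rearrange = solve-∀

  *-^-distrib : (a b n : ℕ) → (a * b) ^ n ≡ a ^ n * b ^ n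
  *-^-distrib a b zero    = refl
  *-^-distrib a b (suc n) = trans (cong (a * b *_) (*-^-distrib a b n)) (interchange a b (a ^ n) (b ^ n))
    where
    interchange : ∀ a b p q → a * b * (p * q) ≡ a * p * (b * q)
    interchange = solve-∀

  hadamard-bound-arithmetic : (s′ A : ℕ) →
    suc s′ * (suc s′ * (suc s′ * (suc s′ * (A * A)) ^ s′)) ≡ suc s′ ^ (suc s′ + 2) * A ^ (2 * s′)
  hadamard-bound-arithmetic s′ A = begin
    s * (s * (s * (s * (A * A)) ^ s′))       ≡⟨ cong (λ x → s * (s * (s * x))) (trans (*-^-distrib s (A * A) s′)
                                                   (cong (s ^ s′ *_) (*-^-distrib A A s′))) ⟩
    s * (s * (s * (s ^ s′ * (A ^ s′ * A ^ s′)))) ≡⟨ rearrange s (s ^ s′) (A ^ s′) ⟩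
    s ^ s * s ^ 2 * (A ^ s′ * A ^ s′)         ≡⟨ cong₂ _*_ (^-distribˡ-+-* s s 2) (^-distribˡ-+-* A s′ s′) ⟨
    s ^ (s + 2) * A ^ (s′ + s′)               ≡⟨ cong (λ e → s ^ (s + 2) * A ^ (s′ + e)) (+-identityʳ s′) ⟨
    s ^ (s + 2) * A ^ (2 * s′)                ∎
    where
    open ≡-Reasoning
    s = suc s′
    rearrange : ∀ s p q → s * (s * (s * (p * (q * q)))) ≡ s * p * (s * (s * 1)) * (q * q)
    rearrange = solve-∀

open import Data.Nat using (ℕ; suc; _≤_; _+_; _*_; _^_; _∸_)
open import Data.Integer as ℤ using (ℤ; ∣_∣)
open import Data.Fin using (Fin)
open import Data.Product using (Σ; _×_; _,_)
open import Data.Nat.Properties using (*-mono-≤; *-identityˡ; *-identityʳ; module ≤-Reasoning)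
import Data.Integer.Properties as ℤ
open import Relation.Binary.PropositionalEquality
open NonsingularSubmatrix using (columns; nonsingular-columns; scatter; mulVec-scatter)
open Cramer using (adj𝟙; B∙εadj𝟙≡ε*det; ∣adj𝟙∣²≤; unit-making-positive)
open ℓ₁Bounds using (norm1-scatter; Σℕ-square≤; hadamard-bound-arithmetic)

lemma4p6 : (s t : ℕ) (M : Matrix s t) (A : ℕ) → 1 ≤ s → ((i : Fin s) (j : Fin t) → ∣ M i j ∣ ≤ A) → HasFullRowRank M
    → Σ (Fin t → ℤ) (λ b → (norm1 b ^ 2 ≤ s ^ (s + 2) * A ^ (2 * (s ∸ 1))) × ((i : Fin s) → ℤ.0ℤ ℤ.< mulVec M b i))
lemma4p6 (suc s′) t M A _ ∣M∣≤A full-rank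
  with σ , det≢0 ← nonsingular-columns M full-rank
  with ε , ∣ε∣≡1 , 0<ε*det ← unit-making-positive det≢0 = scatter σ y , ‖b‖₁²≤ , Mb>0
  where
  s = suc s′
  B = columns M σ
  y : Fin s → ℤ
  y k = ε ℤ.* adj𝟙 B k
  Mb>0 : ∀ i → ℤ.0ℤ ℤ.< mulVec M (scatter σ y) i
  Mb>0 i = subst (ℤ.0ℤ ℤ.<_) (sym (trans (mulVec-scatter M σ y i) (B∙εadj𝟙≡ε*det B ε i))) 0<ε*det
  ∣y∣²≤ : ∀ k → ∣ y k ∣ * ∣ y k ∣ ≤ s * (s * (A * A)) ^ s′
  ∣y∣²≤ k = subst (λ z → z * z ≤ _) (sym ∣y∣≡∣adj𝟙∣) (∣adj𝟙∣²≤ B A (λ i j → ∣M∣≤A i (σ j)) k)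
    where
    ∣y∣≡∣adj𝟙∣ : ∣ y k ∣ ≡ ∣ adj𝟙 B k ∣
    ∣y∣≡∣adj𝟙∣ = trans (ℤ.abs-* ε (adj𝟙 B k)) (trans (cong (_* ∣ adj𝟙 B k ∣) ∣ε∣≡1) (*-identityˡ _))
  ‖b‖₁²≤ : norm1 (scatter σ y) ^ 2 ≤ s ^ (s + 2) * A ^ (2 * s′)
  ‖b‖₁²≤ = begin
    norm1 (scatter σ y) ^ 2                          ≡⟨ cong (norm1 (scatter σ y) *_) (*-identityʳ _) ⟩
    norm1 (scatter σ y) * norm1 (scatter σ y)        ≤⟨ *-mono-≤ (norm1-scatter σ y) (norm1-scatter σ y) ⟩
    Σℕ s (λ k → ∣ y k ∣) * Σℕ s (λ k → ∣ y k ∣)      ≤⟨ Σℕ-square≤ (λ k → ∣ y k ∣) ∣y∣²≤ ⟩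
    s * (s * (s * (s * (A * A)) ^ s′))               ≡⟨ hadamard-bound-arithmetic s′ A ⟩
    s ^ (s + 2) * A ^ (2 * s′)                       ∎
    where open ≤-Reasoning
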